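{- Let $k\ge1$, $a\ge1$, $b\ge0$, $c\ge1$ be integers, and let $g_{p,k,\varphi}(n):=v_p(g_{k,\varphi}(n))$ where $$g_{k,\varphi}(n):=\frac{\prod_{i=0}^k \varphi(b+a(n+ic))}{\varphi\big(\mathrm{lcm}_{0\le i\le k}\{b+a(n+ic)\}\big)}\quad(n\ge1),$$ and let $P_{p,k,\varphi}$ denote the smallest period of $g_{p,k,\varphi}$. Let $p$ be a prime such that $p\le cL_k$ and $p\nmid cL_k$. Then $$P_{p,k,\varphi}=\prod_{\substack{q \text{ prime}:\ q\mid c,\\ q\nmid a,\ p\mid (q-1)}} q.$$
   Context: $\varphi$ is Euler's phi function, $L_k:=\mathrm{lcm}(1,\ldots,k)$, $v_p$ is the $p$-adic valuation. The smallest period of a periodic function $g$ on positive integers is the least positive integer $T$ with $g(n+T)=g(n)$ for all $n\ge1$. An empty product equals $1$. -}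

module Defs where

open import Data.Nat using (ℕ; zero; suc; _+_; _*_; _∸_; _^_; _≤_; _<_)
open import Data.Nat.DivMod using (_/_)
open import Data.Nat.Divisibility using (_∣_; _∣?_)
open import Data.Nat.Coprimality using (coprime?)
open import Data.Nat.Primality using (Prime; prime?)
open import Data.Nat.LCM using (lcm)
open import Data.Nat.ListAction using (product)
open import Data.List using (List; map; foldr; upTo; filter; length)
open import Data.Integer using (ℤ; +_; _-_)
open import Data.Bool using (Bool; if_then_else_; _∧_; not)
open import Relation.Nullary using (does)
open import Relation.Binary.PropositionalEquality using (_≡_)

φ : ℕ → ℕ
φ n = length (filter (λ m → coprime? (suc m) n) (upTo n))

-- p-adic valuation v_p(n) for n ≥ 1, p ≥ 2 (largest e with p^e ∣ n);
-- computed with fuel (fuel n suffices since v_p(n) ≤ n).  Junk value 0 for p < 2 or n = 0.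
vAux : ℕ → ℕ → ℕ → ℕ
vAux zero    p n = 0
vAux (suc f) zero n = 0
vAux (suc f) (suc zero) n = 0
vAux (suc f) (suc (suc q)) zero = 0
vAux (suc f) (suc (suc q)) (suc m) with does (suc (suc q) ∣? suc m)
... | Bool.true  = suc (vAux f (suc (suc q)) (suc m / suc (suc q)))
... | Bool.false = 0

v : ℕ → ℕ → ℕ
v p n = vAux n p n

lcmList : List ℕ → ℕ
lcmList = foldr lcm 1

L : ℕ → ℕ
L k = lcmList (map suc (upTo k))

terms : ℕ → ℕ → ℕ → ℕ → ℕ → List ℕ
terms k a b c n = map (λ i → b + a * (n + i * c)) (upTo (suc k))

gNum : ℕ → ℕ → ℕ → ℕ → ℕ → ℕ
gNum k a b c n = product (map φ (terms k a b c n))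

gDen : ℕ → ℕ → ℕ → ℕ → ℕ → ℕ
gDen k a b c n = φ (lcmList (terms k a b c n))

gp : ℕ → ℕ → ℕ → ℕ → ℕ → ℕ → ℤ
gp p k a b c n = + v p (gNum k a b c n) - + v p (gDen k a b c n)

IsPeriod : {A : Set} → (ℕ → A) → ℕ → Set
IsPeriod f T = 1 ≤ T × ∀ n → 1 ≤ n → f (n + T) ≡ f n
  where open import Data.Product using (_×_)

IsSmallestPeriod : {A : Set} → (ℕ → A) → ℕ → Set
IsSmallestPeriod f T = IsPeriod f T × (∀ T′ → IsPeriod f T′ → T ≤ T′)
  where open import Data.Product using (_×_)

-- ∏ over primes q with q ∣ c, q ∤ a, p ∣ (q - 1)   (such q satisfy q ≤ c when c ≥ 1)
primeProd : ℕ → ℕ → ℕ → ℕ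
primeProd p a c = product (map (λ q → if does (prime? q) ∧ does (q ∣? c) ∧ not (does (q ∣? a)) ∧ does (p ∣? (q ∸ 1)) then q else 1) (upTo (suc c)))

module Submission where

-- For m ≥ 1,  v_p(φ m) = Σ_{q prime, q ∣ m} v_p(q - 1) + (v_p(m) - 1)  (truncated subtraction).
-- Applied to every term and to their lcm, this splits g_{p,k,φ}(n) prime by prime.  Since p > k
-- and p ∤ c, all valuations v_p(T n i) but at most one equal a common value u, the odd one being
-- the largest, so p contributes the constant k (u - 1).  A prime q with v_p(q - 1) > 0 exceeds k:
-- if q ∣ a all terms are ≡ b (mod q), if q ∤ a and q ∣ c all are ≡ b + a n, and otherwise at most
-- one term is divisible by q; so q contributes v_p(q - 1) times k [q ∣ b], k [q ∣ b + a n] or 0.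
-- Hence g_{p,k,φ}(n) = E n + k (u - 1), where E depends on n only through the indicators
-- [q ∣ b + a n] of the primes q dividing D; so D is a period.  Choosing n₀ with D ∣ b + a n₀ makes
-- E maximal, and a period T′ keeps E (n₀ + T′) maximal, which forces each q ∣ D to divide a T′,
-- hence T′; so D ∣ T′.

open import Defs
open import Data.Nat using (ℕ; _≤_; _*_)
open import Data.Nat.Divisibility using (_∣_)
open import Data.Nat.Primality using (Prime)
open import Relation.Nullary using (¬_)
open import Data.Product using (_,_)

module FiniteSums where

  open import Data.Nat
  open import Data.Nat.Properties
  open import Data.Nat.Divisibility using (_∣?_)
  open import Data.Empty using (⊥-elim)
  open import Relation.Nullary using (¬_; Dec; yes; no)
  open import Relation.Binary.PropositionalEquality
  open import Algebra.Properties.CommutativeSemigroup +-commutativeSemigroup using (interchange; xy∙z≈xz∙y)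

  indicator : {A : Set} → Dec A → ℕ
  indicator (yes _) = 1
  indicator (no _) = 0

  indicator-yes : {A : Set} (d : Dec A) → A → indicator d ≡ 1
  indicator-yes (yes _) _ = refl
  indicator-yes (no ¬a) a = ⊥-elim (¬a a)

  indicator-no : {A : Set} (d : Dec A) → ¬ A → indicator d ≡ 0
  indicator-no (yes a) ¬a = ⊥-elim (¬a a)
  indicator-no (no _) _ = refl

  indicator≡1⇒ : {A : Set} (d : Dec A) → indicator d ≡ 1 → A
  indicator≡1⇒ (yes a) _ = a

  indicator-cong : {A B : Set} (d : Dec A) (e : Dec B) → (A → B) → (B → A) → indicator d ≡ indicator e
  indicator-cong (yes a) e f g = sym (indicator-yes e (f a))
  indicator-cong (no ¬a) e f g = sym (indicator-no e (λ b → ¬a (g b)))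

  indicator≤1 : {A : Set} (d : Dec A) → indicator d ≤ 1
  indicator≤1 (yes _) = ≤-refl
  indicator≤1 (no _) = z≤n

  divInd : ℕ → ℕ → ℕ
  divInd q x = indicator (q ∣? x)

  Σ< : ℕ → (ℕ → ℕ) → ℕ
  Σ< zero f = 0
  Σ< (suc n) f = f 0 + Σ< n (λ i → f (suc i))

  max< : ℕ → (ℕ → ℕ) → ℕ
  max< zero f = 0
  max< (suc n) f = f 0 ⊔ max< n (λ i → f (suc i))

  Σ<-cong : ∀ n {f g : ℕ → ℕ} → (∀ i → i < n → f i ≡ g i) → Σ< n f ≡ Σ< n g
  Σ<-cong zero eq = refl
  Σ<-cong (suc n) eq = cong₂ _+_ (eq 0 z<s) (Σ<-cong n (λ i i<n → eq (suc i) (s<s i<n)))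

  Σ<-+ : ∀ n (f g : ℕ → ℕ) → Σ< n (λ i → f i + g i) ≡ Σ< n f + Σ< n g
  Σ<-+ zero f g = refl
  Σ<-+ (suc n) f g = begin
    f 0 + g 0 + Σ< n (λ i → f (suc i) + g (suc i))  ≡⟨ cong (f 0 + g 0 +_) (Σ<-+ n _ _) ⟩
    f 0 + g 0 + (Σ< n (λ i → f (suc i)) + Σ< n (λ i → g (suc i)))
      ≡⟨ interchange (f 0) (g 0) _ _ ⟩
    f 0 + Σ< n (λ i → f (suc i)) + (g 0 + Σ< n (λ i → g (suc i)))  ∎
    where open ≡-Reasoning

  Σ<-*ˡ : ∀ n c (f : ℕ → ℕ) → Σ< n (λ i → c * f i) ≡ c * Σ< n f
  Σ<-*ˡ zero c f = sym (*-zeroʳ c)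
  Σ<-*ˡ (suc n) c f = trans (cong (c * f 0 +_) (Σ<-*ˡ n c _)) (sym (*-distribˡ-+ c (f 0) _))

  Σ<-zero : ∀ n {f : ℕ → ℕ} → (∀ i → i < n → f i ≡ 0) → Σ< n f ≡ 0
  Σ<-zero zero _ = refl
  Σ<-zero (suc n) eq = cong₂ _+_ (eq 0 z<s) (Σ<-zero n (λ i i<n → eq (suc i) (s<s i<n)))

  Σ<-const : ∀ n c → Σ< n (λ _ → c) ≡ n * c
  Σ<-const zero c = refl
  Σ<-const (suc n) c = cong (c +_) (Σ<-const n c)

  Σ<-split : ∀ m n (f : ℕ → ℕ) → Σ< (m + n) f ≡ Σ< m f + Σ< n (λ i → f (m + i))
  Σ<-split zero n f = refl
  Σ<-split (suc m) n f = trans (cong (f 0 +_) (Σ<-split m n _)) (sym (+-assoc (f 0) _ _))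

  Σ<-extend : ∀ m n (f : ℕ → ℕ) → m ≤ n → (∀ i → m ≤ i → f i ≡ 0) → Σ< n f ≡ Σ< m f
  Σ<-extend m n f m≤n vanish = begin
    Σ< n f                                ≡⟨ cong (λ l → Σ< l f) (sym (m+[n∸m]≡n m≤n)) ⟩
    Σ< (m + (n ∸ m)) f                    ≡⟨ Σ<-split m (n ∸ m) f ⟩
    Σ< m f + Σ< (n ∸ m) (λ i → f (m + i)) ≡⟨ cong (Σ< m f +_) (Σ<-zero (n ∸ m) (λ i _ → vanish (m + i) (m≤m+n m i))) ⟩
    Σ< m f + 0                            ≡⟨ +-identityʳ _ ⟩
    Σ< m f                                ∎
    where open ≡-Reasoning

  Σ<-single : ∀ n i₀ c (f g : ℕ → ℕ) → i₀ < n → (∀ i → i < n → i ≢ i₀ → f i ≡ g i) →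
              f i₀ ≡ g i₀ + c → Σ< n f ≡ Σ< n g + c
  Σ<-single (suc n) zero c f g _ agree at =
    trans (cong₂ _+_ at (Σ<-cong n (λ i i<n → agree (suc i) (s<s i<n) (λ ())))) (xy∙z≈xz∙y (g 0) c _)
  Σ<-single (suc n) (suc i₀) c f g (s<s i₀<n) agree at =
    trans (cong₂ _+_ (agree 0 z<s (λ ()))
                     (Σ<-single n i₀ c _ _ i₀<n (λ i i<n i≢ → agree (suc i) (s<s i<n) (λ eq → i≢ (suc-injective eq))) at))
          (sym (+-assoc (g 0) _ c))

  Σ<-mono-≤ : ∀ n (f g : ℕ → ℕ) → (∀ i → i < n → f i ≤ g i) → Σ< n f ≤ Σ< n g
  Σ<-mono-≤ zero f g _ = z≤n
  Σ<-mono-≤ (suc n) f g le = +-mono-≤ (le 0 z<s) (Σ<-mono-≤ n _ _ (λ i i<n → le (suc i) (s<s i<n)))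

  Σ<-≤-equal : ∀ n (f g : ℕ → ℕ) → (∀ i → i < n → f i ≤ g i) → Σ< n f ≡ Σ< n g → ∀ i → i < n → f i ≡ g i
  Σ<-≤-equal (suc n) f g le eq = pointwise
    where
    le₀ = le 0 z<s
    leₜ = Σ<-mono-≤ n _ _ (λ i i<n → le (suc i) (s<s i<n))
    eq₀ : f 0 ≡ g 0
    eq₀ = ≤-antisym le₀ (+-cancelʳ-≤ _ (g 0) (f 0) (≤-trans (+-monoʳ-≤ (g 0) leₜ) (≤-reflexive (sym eq))))
    eqₜ : Σ< n (λ i → f (suc i)) ≡ Σ< n (λ i → g (suc i))
    eqₜ = +-cancelˡ-≡ (f 0) _ _ (trans eq (cong (_+ _) (sym eq₀)))
    pointwise : ∀ i → i < suc n → f i ≡ g i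
    pointwise zero _ = eq₀
    pointwise (suc i) (s<s i<n) = Σ<-≤-equal n _ _ (λ j j<n → le (suc j) (s<s j<n)) eqₜ i i<n

  Σ<-swap : ∀ m n (h : ℕ → ℕ → ℕ) → Σ< m (λ i → Σ< n (λ j → h j i)) ≡ Σ< n (λ j → Σ< m (λ i → h j i))
  Σ<-swap zero n h = sym (Σ<-zero n (λ _ _ → refl))
  Σ<-swap (suc m) n h = trans (cong (Σ< n (λ j → h j 0) +_) (Σ<-swap m n (λ j i → h j (suc i))))
                              (sym (Σ<-+ n (λ j → h j 0) (λ j → Σ< m (λ i → h j (suc i)))))

  Σ<-blocks : ∀ q N (f : ℕ → ℕ) → Σ< (q * N) f ≡ Σ< N (λ y → Σ< q (λ r → f (q * y + r)))
  Σ<-blocks q zero f rewrite *-zeroʳ q = refl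
  Σ<-blocks q (suc N) f = begin
    Σ< (q * suc N) f                                           ≡⟨ cong (λ l → Σ< l f) (*-suc q N) ⟩
    Σ< (q + q * N) f                                           ≡⟨ Σ<-split q (q * N) f ⟩
    Σ< q f + Σ< (q * N) (λ i → f (q + i))                      ≡⟨ cong₂ _+_ first (Σ<-blocks q N _) ⟩
    Σ< q (λ r → f (q * 0 + r)) + Σ< N (λ y → Σ< q (λ r → f (q + (q * y + r))))
      ≡⟨ cong (Σ< q (λ r → f (q * 0 + r)) +_) (Σ<-cong N (λ y _ → Σ<-cong q (λ r _ → cong f (shift y r)))) ⟩
    Σ< q (λ r → f (q * 0 + r)) + Σ< N (λ y → Σ< q (λ r → f (q * suc y + r))) ∎
    where
    open ≡-Reasoning
    first : Σ< q f ≡ Σ< q (λ r → f (q * 0 + r))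
    first = Σ<-cong q (λ r _ → cong (λ x → f (x + r)) (sym (*-zeroʳ q)))
    shift : ∀ y r → q + (q * y + r) ≡ q * suc y + r
    shift y r = trans (sym (+-assoc q (q * y) r)) (cong (_+ r) (sym (*-suc q y)))

  max<-upper : ∀ n (f : ℕ → ℕ) i → i < n → f i ≤ max< n f
  max<-upper (suc n) f zero _ = m≤m⊔n (f 0) _
  max<-upper (suc n) f (suc i) (s<s i<n) = ≤-trans (max<-upper n _ i i<n) (m≤n⊔m (f 0) _)

  max<-const : ∀ n (f : ℕ → ℕ) u → (∀ i → i < suc n → f i ≡ u) → max< (suc n) f ≡ u
  max<-const zero f u eq = trans (⊔-identityʳ (f 0)) (eq 0 z<s)
  max<-const (suc n) f u eq =
    trans (cong₂ _⊔_ (eq 0 z<s) (max<-const n _ u (λ i i<n → eq (suc i) (s<s i<n)))) (⊔-idem u)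

  AtMostOne : ℕ → (ℕ → Set) → Set
  AtMostOne n P = ∀ i j → i < n → j < n → P i → P j → i ≡ j

  AtMostOne-tail : ∀ {n} {P : ℕ → Set} → AtMostOne (suc n) P → AtMostOne n (λ i → P (suc i))
  AtMostOne-tail unique i j i<n j<n Pi Pj = suc-injective (unique (suc i) (suc j) (s<s i<n) (s<s j<n) Pi Pj)

  Σ<-excess : ∀ k (f : ℕ → ℕ) u → (∀ i → i < suc k → u ≤ f i) → AtMostOne (suc k) (λ i → f i ≢ u) →
              Σ< (suc k) (λ i → f i ∸ 1) ≡ k * (u ∸ 1) + (max< (suc k) f ∸ 1)
  Σ<-excess zero f u _ _ = trans (+-identityʳ _) (cong (_∸ 1) (sym (⊔-identityʳ (f 0))))
  Σ<-excess (suc k) f u u≤f unique with f 0 ≟ u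
  ... | yes f₀≡u = begin
    (f 0 ∸ 1) + Σ< (suc k) (λ i → f (suc i) ∸ 1)  ≡⟨ cong₂ _+_ (cong (_∸ 1) f₀≡u) tail-sum ⟩
    (u ∸ 1) + (k * (u ∸ 1) + (tailMax ∸ 1))       ≡⟨ sym (+-assoc (u ∸ 1) _ _) ⟩
    suc k * (u ∸ 1) + (tailMax ∸ 1)               ≡˘⟨ cong (λ x → suc k * (u ∸ 1) + (x ∸ 1)) max≡ ⟩
    suc k * (u ∸ 1) + (max< (suc (suc k)) f ∸ 1)  ∎
    where
    open ≡-Reasoning
    tailMax = max< (suc k) (λ i → f (suc i))
    tail-sum : Σ< (suc k) (λ i → f (suc i) ∸ 1) ≡ k * (u ∸ 1) + (tailMax ∸ 1)
    tail-sum = Σ<-excess k (λ i → f (suc i)) u (λ i i<k → u≤f (suc i) (s<s i<k)) (AtMostOne-tail unique)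
    -- f 0 = u is not above the maximum of the others.
    max≡ : max< (suc (suc k)) f ≡ tailMax
    max≡ = trans (cong (_⊔ tailMax) f₀≡u) (m≤n⇒m⊔n≡n (≤-trans (u≤f 1 (s<s z<s)) (max<-upper (suc k) (λ i → f (suc i)) 0 z<s)))
  ... | no f₀≢u = begin
    (f 0 ∸ 1) + Σ< (suc k) (λ i → f (suc i) ∸ 1)  ≡⟨ cong ((f 0 ∸ 1) +_) tail-sum ⟩
    (f 0 ∸ 1) + suc k * (u ∸ 1)                   ≡⟨ +-comm (f 0 ∸ 1) _ ⟩
    suc k * (u ∸ 1) + (f 0 ∸ 1)                   ≡˘⟨ cong (λ x → suc k * (u ∸ 1) + (x ∸ 1)) max≡ ⟩
    suc k * (u ∸ 1) + (max< (suc (suc k)) f ∸ 1)  ∎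
    where
    open ≡-Reasoning
    -- f 0 is the exceptional value, so all the others equal u.
    tail≡u : ∀ i → i < suc k → f (suc i) ≡ u
    tail≡u i i<k with f (suc i) ≟ u
    ... | yes eq = eq
    ... | no neq with () ← unique 0 (suc i) z<s (s<s i<k) f₀≢u neq
    tail-sum : Σ< (suc k) (λ i → f (suc i) ∸ 1) ≡ suc k * (u ∸ 1)
    tail-sum = trans (Σ<-cong (suc k) (λ i i<k → cong (_∸ 1) (tail≡u i i<k))) (Σ<-const (suc k) (u ∸ 1))
    max≡ : max< (suc (suc k)) f ≡ f 0
    max≡ = trans (cong (f 0 ⊔_) (max<-const k (λ i → f (suc i)) u tail≡u)) (m≥n⇒m⊔n≡m (u≤f 0 z<s))

module Valuation where

  open import Data.Nat
  open import Data.Nat.Properties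
  open import Data.Nat.Divisibility
  open import Data.Nat.DivMod using (_/_; m/n<m; m≥n⇒m/n>0)
  open import Data.Nat.Primality using (Prime; euclidsLemma; prime⇒nonZero; prime⇒irreducible)
  open import Data.Nat.LCM using (lcm; lcm-least; m∣lcm[m,n]; n∣lcm[m,n]; gcd*lcm)
  open import Data.Nat.GCD using (gcd)
  open import Data.Nat.Primality.Factorisation using (factorise)
  open import Data.Nat.ListAction using (product)
  open import Data.List using ([]; _∷_)
  open import Data.List.Relation.Unary.All using (_∷_)
  open import Data.Product using (_×_; _,_; Σ-syntax)
  open import Data.Sum using (inj₁; inj₂; [_,_]′)
  open import Data.Empty using (⊥-elim)
  open import Relation.Nullary using (¬_; yes; no; does)
  open import Relation.Nullary.Decidable using (dec-true; dec-false)
  open import Data.Bool using (true; false)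
  open import Relation.Binary.PropositionalEquality
  open import Algebra.Properties.CommutativeSemigroup *-commutativeSemigroup using (interchange)

  prime≥2 : ∀ {p} → Prime p → 2 ≤ p
  prime≥2 {suc (suc _)} _ = s≤s (s≤s z≤n)

  prime∣prime : ∀ {p r} → Prime p → Prime r → p ∣ r → p ≡ r
  prime∣prime pp pr p∣r with prime⇒irreducible pr p∣r
  ... | inj₁ refl = ⊥-elim (<⇒≱ (prime≥2 pp) ≤-refl)
  ... | inj₂ p≡r = p≡r

  ∣m+n∣n⇒∣m : ∀ {d m n} → d ∣ m + n → d ∣ n → d ∣ m
  ∣m+n∣n⇒∣m {d} {m} {n} d∣m+n = ∣m+n∣m⇒∣n (subst (d ∣_) (+-comm m n) d∣m+n)

  ^-monoʳ-∣ : ∀ p {i j} → i ≤ j → p ^ i ∣ p ^ j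
  ^-monoʳ-∣ p {i} {j} i≤j = divides (p ^ (j ∸ i)) (begin
    p ^ j               ≡⟨ cong (p ^_) (sym (m+[n∸m]≡n i≤j)) ⟩
    p ^ (i + (j ∸ i))   ≡⟨ ^-distribˡ-+-* p i (j ∸ i) ⟩
    p ^ i * p ^ (j ∸ i) ≡⟨ *-comm (p ^ i) _ ⟩
    p ^ (j ∸ i) * p ^ i ∎)
    where open ≡-Reasoning

  module _ (q : ℕ) where
    private
      P : ℕ
      P = suc (suc q)

    vAux-∣ : ∀ {f m} → P ∣ suc m → vAux (suc f) P (suc m) ≡ suc (vAux f P (suc m / P))
    vAux-∣ {f} {m} P∣m with does (P ∣? suc m) | dec-true (P ∣? suc m) P∣m
    ... | true | refl = refl

    vAux-∤ : ∀ {f m} → ¬ (P ∣ suc m) → vAux (suc f) P (suc m) ≡ 0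
    vAux-∤ {f} {m} P∤m with does (P ∣? suc m) | dec-false (P ∣? suc m) P∤m
    ... | false | refl = refl

    vAux-sound : ∀ f m → P ^ vAux f P m ∣ m
    vAux-sound zero m = 1∣ m
    vAux-sound (suc f) zero = 1∣ 0
    vAux-sound (suc f) (suc m) with P ∣? suc m
    ... | no P∤m rewrite vAux-∤ {f} P∤m = 1∣ suc m
    ... | yes P∣m rewrite vAux-∣ {f} P∣m = m∣n/o⇒o*m∣n P∣m (vAux-sound f (suc m / P))

    vAux-complete : ∀ f m j → m ≤ f → 1 ≤ m → P ^ j ∣ m → j ≤ vAux f P m
    vAux-complete f m zero _ _ _ = z≤n
    vAux-complete zero (suc m) (suc j) () _ _
    vAux-complete (suc f) (suc m) (suc j) (s≤s m≤f) _ Pʲ⁺¹∣m with P ∣? suc m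
    ... | no P∤m = ⊥-elim (P∤m (∣-trans (m∣m*n (P ^ j)) Pʲ⁺¹∣m))
    ... | yes P∣m rewrite vAux-∣ {f} P∣m = s≤s (vAux-complete f (suc m / P) j quotient≤f quotient≥1 (m*n∣o⇒n∣o/m P (P ^ j) Pʲ⁺¹∣m))
      where
      quotient≤f : suc m / P ≤ f
      quotient≤f = ≤-pred (≤-trans (m/n<m (suc m) P (s≤s (s≤s z≤n))) (s≤s m≤f))
      quotient≥1 : 1 ≤ suc m / P
      quotient≥1 = m≥n⇒m/n>0 (∣⇒≤ P∣m)

  v-divides : ∀ {p} m → 2 ≤ p → p ^ v p m ∣ m
  v-divides {suc (suc q)} m (s≤s (s≤s z≤n)) = vAux-sound q m m

  ≤v⇒∣ : ∀ {p m j} → 2 ≤ p → j ≤ v p m → p ^ j ∣ m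
  ≤v⇒∣ {p} {m} p≥2 j≤v = ∣-trans (^-monoʳ-∣ p j≤v) (v-divides m p≥2)

  ∣⇒≤v : ∀ {p m j} → 2 ≤ p → 1 ≤ m → p ^ j ∣ m → j ≤ v p m
  ∣⇒≤v {suc (suc q)} {m} {j} (s≤s (s≤s z≤n)) m≥1 = vAux-complete q m m j ≤-refl m≥1

  p^1∣⇒p∣ : ∀ {p m} → p ^ 1 ∣ m → p ∣ m
  p^1∣⇒p∣ {p} = subst (_∣ _) (*-identityʳ p)

  p∣⇒p^1∣ : ∀ {p m} → p ∣ m → p ^ 1 ∣ m
  p∣⇒p^1∣ {p} = subst (_∣ _) (sym (*-identityʳ p))

  v≥1⇒∣ : ∀ {p m} → 2 ≤ p → 1 ≤ v p m → p ∣ m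
  v≥1⇒∣ p≥2 v≥1 = p^1∣⇒p∣ (≤v⇒∣ p≥2 v≥1)

  ∣⇒v≥1 : ∀ {p m} → 2 ≤ p → 1 ≤ m → p ∣ m → 1 ≤ v p m
  ∣⇒v≥1 p≥2 m≥1 p∣m = ∣⇒≤v p≥2 m≥1 (p∣⇒p^1∣ p∣m)

  v-exact : ∀ {p m e} → 2 ≤ p → 1 ≤ m → p ^ e ∣ m → ¬ (p ^ suc e ∣ m) → v p m ≡ e
  v-exact p≥2 m≥1 pᵉ∣m pᵉ⁺¹∤m = ≤-antisym (≮⇒≥ (λ e<v → pᵉ⁺¹∤m (≤v⇒∣ p≥2 e<v))) (∣⇒≤v p≥2 m≥1 pᵉ∣m)

  v-decomposition : ∀ {p} m → 2 ≤ p → 1 ≤ m → Σ[ m' ∈ ℕ ] m ≡ p ^ v p m * m' × ¬ (p ∣ m')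
  v-decomposition {p} m p≥2 m≥1 = quotient pᵛ∣m , m∣n⇒n≡m*quotient pᵛ∣m , p∤m'
    where
    pᵛ∣m = v-divides m p≥2
    p∤m' : ¬ (p ∣ quotient pᵛ∣m)
    p∤m' p∣m' = 1+n≰n (∣⇒≤v p≥2 m≥1 pᵛ⁺¹∣m)
      where
      pᵛ⁺¹∣m : p ^ suc (v p m) ∣ m
      pᵛ⁺¹∣m = subst₂ _∣_ (*-comm (p ^ v p m) p) (sym (m∣n⇒n≡m*quotient pᵛ∣m)) (*-monoʳ-∣ (p ^ v p m) p∣m')

  v-bound : ∀ {p m e r} → Prime p → 1 ≤ m → m ∣ p ^ e * r → ¬ (p ∣ r) → v p m ≤ e
  v-bound {p} {m} {e} {r} pp m≥1 m∣ p∤r with v p m ≤? e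
  ... | yes v≤e = v≤e
  ... | no v≰e = ⊥-elim (p∤r (*-cancelˡ-∣ (p ^ e) {{m^n≢0 p e {{prime⇒nonZero pp}}}} pᵉp∣pᵉr))
    where
    pᵉp∣pᵉr : p ^ e * p ∣ p ^ e * r
    pᵉp∣pᵉr = subst (_∣ p ^ e * r) (*-comm p (p ^ e)) (∣-trans (≤v⇒∣ (prime≥2 pp) (≰⇒> v≰e)) m∣)

  v-unique : ∀ {p m e r} → Prime p → 1 ≤ m → p ^ e ∣ m → m ∣ p ^ e * r → ¬ (p ∣ r) → v p m ≡ e
  v-unique pp m≥1 pᵉ∣m m∣ p∤r = ≤-antisym (v-bound pp m≥1 m∣ p∤r) (∣⇒≤v (prime≥2 pp) m≥1 pᵉ∣m)

  v-zero : ∀ {p m} → Prime p → ¬ (p ∣ m) → v p m ≡ 0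
  v-zero {p} {zero} pp p∤0 = ⊥-elim (p∤0 (p ∣0))
  v-zero {p} {suc m} pp p∤m = v-unique pp (s≤s z≤n) (1∣ _) (∣-reflexive (sym (*-identityˡ (suc m)))) p∤m

  v-pow : ∀ {p} → Prime p → ∀ e → v p (p ^ e) ≡ e
  v-pow {p} pp e = v-unique pp (m^n>0 p {{prime⇒nonZero pp}} e) ∣-refl (∣-reflexive (sym (*-identityʳ (p ^ e)))) p∤1
    where
    p∤1 : ¬ (p ∣ 1)
    p∤1 p∣1 = <⇒≱ (prime≥2 pp) (≤-reflexive (∣1⇒≡1 p∣1))

  v-mul : ∀ {p x y} → Prime p → 1 ≤ x → 1 ≤ y → v p (x * y) ≡ v p x + v p y
  v-mul {p} {x} {y} pp x≥1 y≥1
    with v-decomposition x (prime≥2 pp) x≥1 | v-decomposition y (prime≥2 pp) y≥1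
  ... | x' , x≡ , p∤x' | y' , y≡ , p∤y' =
    v-unique pp (*-mono-≤ x≥1 y≥1) (subst (p ^ (v p x + v p y) ∣_) (sym xy≡) (m∣m*n (x' * y'))) (∣-reflexive xy≡) p∤x'y'
    where
    xy≡ : x * y ≡ p ^ (v p x + v p y) * (x' * y')
    xy≡ = begin
      x * y                                 ≡⟨ cong₂ _*_ x≡ y≡ ⟩
      p ^ v p x * x' * (p ^ v p y * y')     ≡⟨ interchange (p ^ v p x) x' (p ^ v p y) y' ⟩
      p ^ v p x * p ^ v p y * (x' * y')     ≡⟨ cong (_* (x' * y')) (sym (^-distribˡ-+-* p (v p x) (v p y))) ⟩
      p ^ (v p x + v p y) * (x' * y')       ∎
      where open ≡-Reasoning
    p∤x'y' : ¬ (p ∣ x' * y')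
    p∤x'y' p∣ = [ p∤x' , p∤y' ]′ (euclidsLemma x' y' pp p∣)

  prime∣prime-power : ∀ {p r} → Prime p → Prime r → ∀ e → p ∣ r ^ e → p ≡ r
  prime∣prime-power pp pr zero p∣1 = ⊥-elim (<⇒≱ (prime≥2 pp) (≤-reflexive (∣1⇒≡1 p∣1)))
  prime∣prime-power {p} {r} pp pr (suc e) p∣rʳ with euclidsLemma r (r ^ e) pp p∣rʳ
  ... | inj₁ p∣r = prime∣prime pp pr p∣r
  ... | inj₂ p∣rᵉ = prime∣prime-power pp pr e p∣rᵉ

  v-pow-other : ∀ {p r} → Prime p → Prime r → p ≢ r → ∀ e → v p (r ^ e) ≡ 0
  v-pow-other pp pr p≢r e = v-zero pp (λ p∣rᵉ → p≢r (prime∣prime-power pp pr e p∣rᵉ))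

  lcm-pos : ∀ {x y} → 1 ≤ x → 1 ≤ y → 1 ≤ lcm x y
  lcm-pos {x} {y} x≥1 y≥1 = n≢0⇒n>0 (λ lcm≡0 → <⇒≢ (*-mono-≤ x≥1 y≥1) (sym (begin
    x * y              ≡˘⟨ gcd*lcm x y ⟩
    gcd x y * lcm x y  ≡⟨ cong (gcd x y *_) lcm≡0 ⟩
    gcd x y * 0        ≡⟨ *-zeroʳ (gcd x y) ⟩
    0                  ∎)))
    where open ≡-Reasoning

  -- v_p(lcm(x, y)) = max(v_p x, v_p y):  p ^ max divides the lcm, and the lcm divides
  -- p ^ max · x′ y′ where x = p ^ v_p(x) x′ and y = p ^ v_p(y) y′.
  v-lcm : ∀ {p x y} → Prime p → 1 ≤ x → 1 ≤ y → v p (lcm x y) ≡ v p x ⊔ v p y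
  v-lcm {p} {x} {y} pp x≥1 y≥1
    with v-decomposition x (prime≥2 pp) x≥1 | v-decomposition y (prime≥2 pp) y≥1
  ... | x' , x≡ , p∤x' | y' , y≡ , p∤y' =
    v-unique pp (lcm-pos x≥1 y≥1) pᵐ∣lcm (lcm-least x∣ y∣) (λ p∣ → [ p∤x' , p∤y' ]′ (euclidsLemma x' y' pp p∣))
    where
    a = v p x
    b = v p y
    x∣ : x ∣ p ^ (a ⊔ b) * (x' * y')
    x∣ = subst (_∣ p ^ (a ⊔ b) * (x' * y')) (sym x≡) (*-pres-∣ (^-monoʳ-∣ p (m≤m⊔n a b)) (m∣m*n y'))
    y∣ : y ∣ p ^ (a ⊔ b) * (x' * y')
    y∣ = subst (_∣ p ^ (a ⊔ b) * (x' * y')) (sym y≡) (*-pres-∣ (^-monoʳ-∣ p (m≤n⊔m a b)) (n∣m*n x'))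
    pᵐ∣lcm : p ^ (a ⊔ b) ∣ lcm x y
    pᵐ∣lcm with ⊔-sel a b
    ... | inj₁ eq = subst (λ e → p ^ e ∣ lcm x y) (sym eq) (∣-trans (v-divides x (prime≥2 pp)) (m∣lcm[m,n] x y))
    ... | inj₂ eq = subst (λ e → p ^ e ∣ lcm x y) (sym eq) (∣-trans (v-divides y (prime≥2 pp)) (n∣lcm[m,n] x y))

  prime-divisor : ∀ m → 2 ≤ m → Σ[ r ∈ ℕ ] Prime r × r ∣ m
  prime-divisor (suc zero) (s≤s ())
  prime-divisor m@(suc (suc _)) _ with factorise m
  ... | record { factors = [] ; isFactorisation = () }
  ... | record { factors = r ∷ rs ; isFactorisation = m≡ ; factorsPrime = pr ∷ _ } =
    r , pr , subst (r ∣_) (sym m≡) (m∣m*n (product rs))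

  split-prime-power : ∀ m → 2 ≤ m → Σ[ r ∈ ℕ ] Σ[ e ∈ ℕ ] Σ[ m' ∈ ℕ ] Prime r × ¬ (r ∣ m') × m ≡ r ^ suc e * m'
  split-prime-power m m≥2 with prime-divisor m m≥2
  ... | r , pr , r∣m with v-decomposition m (prime≥2 pr) (≤-trans (s≤s z≤n) m≥2)
  ... | m' , m≡ , r∤m' = r , v r m ∸ 1 , m' , pr , r∤m' , trans m≡ (cong (λ e → r ^ e * m') (sym v≡))
    where
    v≡ : suc (v r m ∸ 1) ≡ v r m
    v≡ = m+[n∸m]≡n (∣⇒v≥1 (prime≥2 pr) (≤-trans (s≤s z≤n) m≥2) r∣m)

module Coprimality where

  open Valuation using (prime∣prime)
  open import Data.Nat
  open import Data.Nat.Properties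
  open import Data.Nat.Divisibility
  open import Data.Nat.Coprimality using (Coprime; coprime-divisor; coprime-Bézout)
  open import Data.Nat.GCD using (module Bézout)
  open import Data.Nat.Primality using (Prime; prime⇒irreducible)
  open import Data.Product using (_×_; _,_; Σ-syntax)
  open import Data.Sum using (inj₁; inj₂)
  open import Data.Empty using (⊥-elim)
  open import Relation.Nullary using (¬_)
  open import Relation.Binary.PropositionalEquality
  open import Data.Nat.Tactic.RingSolver using (solve-∀)

  coprime-* : ∀ {x a b} → Coprime x a → Coprime x b → Coprime x (a * b)
  coprime-* {x} {a} {b} x⊥a x⊥b {d} (d∣x , d∣ab) = x⊥b (d∣x , coprime-divisor d⊥a d∣ab)
    where
    d⊥a : Coprime d a
    d⊥a (e∣d , e∣a) = x⊥a (∣-trans e∣d d∣x , e∣a)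

  coprime-^ : ∀ {x a} → Coprime x a → ∀ e → Coprime x (a ^ e)
  coprime-^ x⊥a zero (_ , d∣1) = ∣1⇒≡1 d∣1
  coprime-^ x⊥a (suc e) = coprime-* x⊥a (coprime-^ x⊥a e)

  coprime-prime : ∀ {x q} → Prime q → ¬ (q ∣ x) → Coprime x q
  coprime-prime {x} {q} pq q∤x {d} (d∣x , d∣q) with prime⇒irreducible pq d∣q
  ... | inj₁ d≡1 = d≡1
  ... | inj₂ refl = ⊥-elim (q∤x d∣x)

  -- For a coprime to D ≥ 1, some n ≥ 1 solves  b + a n ≡ 0 (mod D):  with a x ≡ 1 (mod D)
  -- from Bézout, take n ≡ -b x (mod D).
  linear-congruence : ∀ a b D → 1 ≤ D → Coprime a D → Σ[ n ∈ ℕ ] 1 ≤ n × D ∣ b + a * n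
  linear-congruence a b (suc D') _ a⊥D with coprime-Bézout a⊥D
  ... | Bézout.+- x y 1+yD≡xa = x * b * D' + suc D' , ≤-trans (s≤s z≤n) (m≤n+m (suc D') _) , divides (b + y * b * D' + a) (begin
    b + a * (x * b * D' + suc D')                 ≡⟨ expand a b x D' ⟩
    b + x * a * (b * D') + a * suc D'             ≡˘⟨ cong (λ z → b + z * (b * D') + a * suc D') 1+yD≡xa ⟩
    b + (1 + y * suc D') * (b * D') + a * suc D'  ≡⟨ collect a b y D' ⟩
    (b + y * b * D' + a) * suc D'                 ∎)
    where
    open ≡-Reasoning
    expand : ∀ a b x D' → b + a * (x * b * D' + (1 + D')) ≡ b + x * a * (b * D') + a * (1 + D')
    expand = solve-∀
    collect : ∀ a b y D' → b + (1 + y * (1 + D')) * (b * D') + a * (1 + D') ≡ (b + y * b * D' + a) * (1 + D')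
    collect = solve-∀
  ... | Bézout.-+ x y 1+xa≡yD = x * b + suc D' , ≤-trans (s≤s z≤n) (m≤n+m (suc D') _) , divides (b * y + a) (begin
    b + a * (x * b + suc D')       ≡⟨ expand a b x D' ⟩
    b * (1 + x * a) + a * suc D'   ≡⟨ cong (λ z → b * z + a * suc D') 1+xa≡yD ⟩
    b * (y * suc D') + a * suc D'  ≡⟨ collect a b y D' ⟩
    (b * y + a) * suc D'           ∎)
    where
    open ≡-Reasoning
    expand : ∀ a b x D' → b + a * (x * b + (1 + D')) ≡ b * (1 + x * a) + a * (1 + D')
    expand = solve-∀
    collect : ∀ a b y D' → b * (y * (1 + D')) + a * (1 + D') ≡ (b * y + a) * (1 + D')
    collect = solve-∀

  distinct-primes-coprime : ∀ {i j} → Prime i → Prime j → i ≢ j → Coprime i j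
  distinct-primes-coprime pi pj i≢j {d} (d∣i , d∣j) with prime⇒irreducible pi d∣i
  ... | inj₁ d≡1 = d≡1
  ... | inj₂ refl = ⊥-elim (i≢j (prime∣prime pi pj d∣j))

module Totient where

  open FiniteSums
  open Valuation using (prime≥2)
  open Coprimality using (coprime-*; coprime-^; coprime-prime)
  open import Data.Nat
  open import Data.Nat.Properties
  open import Data.Nat.Divisibility
  open import Data.Nat.Coprimality using (Coprime; coprime?; 1-coprimeTo)
  import Data.Nat.Coprimality as Coprime
  open import Data.Nat.Primality using (Prime)
  open import Data.List using (applyUpTo; filter; length)
  open import Data.Product using (_,_)
  open import Relation.Nullary using (¬_; yes; no)
  open import Relation.Unary using (Pred; Decidable)
  open import Relation.Binary.PropositionalEquality

  length-filter : ∀ {P : Pred ℕ _} (P? : Decidable P) N (g : ℕ → ℕ) →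
    length (filter P? (applyUpTo g N)) ≡ Σ< N (λ i → indicator (P? (g i)))
  length-filter P? zero g = refl
  length-filter P? (suc N) g with P? (g 0)
  ... | yes _ = cong suc (length-filter P? N (λ i → g (suc i)))
  ... | no _ = length-filter P? N (λ i → g (suc i))

  coprimeInd : ℕ → ℕ → ℕ
  coprimeInd n x = indicator (coprime? x n)

  φ-as-sum : ∀ n → φ n ≡ Σ< n (λ i → coprimeInd n (suc i))
  φ-as-sum n = length-filter (λ i → coprime? (suc i) n) n (λ i → i)

  coprimeInd-periodic : ∀ n x → coprimeInd n (n + x) ≡ coprimeInd n x
  coprimeInd-periodic n x = indicator-cong (coprime? (n + x) n) (coprime? x n)
    (λ c (d∣x , d∣n) → c (∣m∣n⇒∣m+n d∣n d∣x , d∣n))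
    (λ c (d∣n+x , d∣n) → c (∣m+n∣m⇒∣n d∣n+x d∣n , d∣n))

  Σ<-coprimeInd : ∀ m j → Σ< (j * m) (λ x → coprimeInd m (suc x)) ≡ j * φ m
  Σ<-coprimeInd m zero = refl
  Σ<-coprimeInd m (suc j) = begin
    Σ< (m + j * m) (λ x → coprimeInd m (suc x))                                 ≡⟨ Σ<-split m (j * m) _ ⟩
    Σ< m (λ x → coprimeInd m (suc x)) + Σ< (j * m) (λ x → coprimeInd m (suc (m + x)))
      ≡⟨ cong₂ _+_ (sym (φ-as-sum m)) (trans (Σ<-cong (j * m) shift) (Σ<-coprimeInd m j)) ⟩
    φ m + j * φ m                                                               ∎
    where
    open ≡-Reasoning
    shift : ∀ x → x < j * m → coprimeInd m (suc (m + x)) ≡ coprimeInd m (suc x)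
    shift x _ = trans (cong (coprimeInd m) (sym (+-suc m x))) (coprimeInd-periodic m (suc x))

  Σ<-multiples : ∀ q N (f : ℕ → ℕ) → 1 ≤ q →
    Σ< (q * N) (λ x → f (suc x) * divInd q (suc x)) ≡ Σ< N (λ y → f (q * suc y))
  Σ<-multiples q N f q≥1 =
    trans (Σ<-blocks q N _) (Σ<-cong N (λ y _ → block y))
    where
    h : ℕ → ℕ
    h x = f (suc x) * divInd q (suc x)
    q≡ : q ≡ suc (q ∸ 1)
    q≡ = sym (m+[n∸m]≡n q≥1)
    -- In the block [q y + 1, q y + q] only the last entry is a multiple of q.
    block : ∀ y → Σ< q (λ r → h (q * y + r)) ≡ f (q * suc y)
    block y = trans (Σ<-single q (q ∸ 1) (f (q * suc y)) _ (λ _ → 0) (subst (q ∸ 1 <_) (sym q≡) ≤-refl) off at)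
                    (cong (_+ f (q * suc y)) (Σ<-zero q (λ _ _ → refl)))
      where
      last : suc (q * y + (q ∸ 1)) ≡ q * suc y
      last = trans (sym (+-suc (q * y) (q ∸ 1))) (trans (cong (q * y +_) (sym q≡)) (trans (+-comm (q * y) q) (sym (*-suc q y))))
      at : h (q * y + (q ∸ 1)) ≡ 0 + f (q * suc y)
      at rewrite last = trans (cong (f (q * suc y) *_) (indicator-yes (q ∣? q * suc y) (m∣m*n (suc y)))) (*-identityʳ _)
      off : ∀ r → r < q → r ≢ q ∸ 1 → h (q * y + r) ≡ 0
      off r r<q r≢ = trans (cong (f (suc (q * y + r)) *_) (indicator-no (q ∣? suc (q * y + r)) q∤)) (*-zeroʳ (f (suc (q * y + r))))
        where
        sr<q : suc r < q
        sr<q = subst (suc r <_) (sym q≡) (s≤s (≤∧≢⇒< (≤-pred (subst (r <_) q≡ r<q)) r≢))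
        q∤ : ¬ (q ∣ suc (q * y + r))
        q∤ q∣ = <⇒≱ sr<q (∣⇒≤ (∣m+n∣m⇒∣n (subst (q ∣_) (sym (+-suc (q * y) r)) q∣) (m∣m*n y)))

  module _ {q m : ℕ} (pq : Prime q) (q∤m : ¬ (q ∣ m)) where

    coprimeInd-split : ∀ e x → coprimeInd m x ≡ coprimeInd (q ^ suc e * m) x + coprimeInd m x * divInd q x
    coprimeInd-split e x with q ∣? x
    ... | yes q∣x = sym (trans (cong (_+ _) (indicator-no (coprime? x (q ^ suc e * m)) not-coprime)) (*-identityʳ _))
      where
      not-coprime : ¬ Coprime x (q ^ suc e * m)
      not-coprime c = <⇒≱ (prime≥2 pq) (≤-reflexive (c (q∣x , ∣-trans (m∣m*n (q ^ e)) (m∣m*n m))))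
    ... | no q∤x = sym (trans (cong₂ _+_ same (*-zeroʳ (coprimeInd m x))) (+-identityʳ _))
      where
      same : coprimeInd (q ^ suc e * m) x ≡ coprimeInd m x
      same = indicator-cong (coprime? x (q ^ suc e * m)) (coprime? x m)
        (λ c (d∣x , d∣m) → c (d∣x , ∣n⇒∣m*n (q ^ suc e) d∣m))
        (λ c → coprime-* (coprime-^ (coprime-prime pq q∤x) (suc e)) c)

    coprimeInd-q* : ∀ z → coprimeInd m (q * z) ≡ coprimeInd m z
    coprimeInd-q* z = indicator-cong (coprime? (q * z) m) (coprime? z m)
      (λ c (d∣z , d∣m) → c (∣n⇒∣m*n q d∣z , d∣m))
      (λ c → Coprime.sym (coprime-* (coprime-prime pq q∤m) (Coprime.sym c)))

    φ-prime-power : ∀ e → φ (q ^ suc e * m) ≡ q ^ e * (q ∸ 1) * φ m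
    φ-prime-power e = +-cancelʳ-≡ X _ _ (begin
      φ N + X                                                        ≡⟨ cong (φ N +_) (sym multiples) ⟩
      φ N + Σ< N (λ x → coprimeInd m (suc x) * divInd q (suc x)) ≡⟨ cong (_+ Σ< N (λ x → coprimeInd m (suc x) * divInd q (suc x))) (φ-as-sum N) ⟩
      Σ< N (λ x → coprimeInd N (suc x)) + Σ< N (λ x → coprimeInd m (suc x) * divInd q (suc x))
        ≡⟨ sym (Σ<-+ N _ _) ⟩
      Σ< N (λ x → coprimeInd N (suc x) + coprimeInd m (suc x) * divInd q (suc x))
        ≡⟨ sym (Σ<-cong N (λ x _ → coprimeInd-split e (suc x))) ⟩
      Σ< N (λ x → coprimeInd m (suc x))                              ≡⟨ Σ<-coprimeInd m (q ^ suc e) ⟩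
      q ^ suc e * φ m                                                ≡⟨ *-assoc q (q ^ e) (φ m) ⟩
      q * X                                                          ≡⟨ cong (_* X) q≡ ⟩
      X + (q ∸ 1) * X                                                ≡⟨ +-comm X _ ⟩
      (q ∸ 1) * X + X                                                ≡⟨ cong (_+ X) reassoc ⟩
      q ^ e * (q ∸ 1) * φ m + X                                      ∎)
      where
      open ≡-Reasoning
      N = q ^ suc e * m
      X = q ^ e * φ m
      q≡ : q ≡ suc (q ∸ 1)
      q≡ = sym (m+[n∸m]≡n (≤-trans (s≤s z≤n) (prime≥2 pq)))
      multiples : Σ< N (λ x → coprimeInd m (suc x) * divInd q (suc x)) ≡ X
      multiples = begin
        Σ< N (λ x → coprimeInd m (suc x) * divInd q (suc x))
          ≡⟨ cong (λ l → Σ< l (λ x → coprimeInd m (suc x) * divInd q (suc x))) (*-assoc q (q ^ e) m) ⟩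
        Σ< (q * (q ^ e * m)) (λ x → coprimeInd m (suc x) * divInd q (suc x))
          ≡⟨ Σ<-multiples q (q ^ e * m) (coprimeInd m) (≤-trans (s≤s z≤n) (prime≥2 pq)) ⟩
        Σ< (q ^ e * m) (λ y → coprimeInd m (q * suc y))         ≡⟨ Σ<-cong (q ^ e * m) (λ y _ → coprimeInd-q* (suc y)) ⟩
        Σ< (q ^ e * m) (λ y → coprimeInd m (suc y))             ≡⟨ Σ<-coprimeInd m (q ^ e) ⟩
        X                                                       ∎
      reassoc : (q ∸ 1) * X ≡ q ^ e * (q ∸ 1) * φ m
      reassoc = trans (sym (*-assoc (q ∸ 1) (q ^ e) (φ m))) (cong (_* φ m) (*-comm (q ∸ 1) (q ^ e)))

  φ≥1 : ∀ {m} → 1 ≤ m → 1 ≤ φ m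
  φ≥1 {suc m} _ = subst (1 ≤_) (sym (φ-as-sum (suc m))) (≤-trans one (m≤m+n (coprimeInd (suc m) 1) _))
    where
    one : 1 ≤ coprimeInd (suc m) 1
    one = ≤-reflexive (sym (indicator-yes (coprime? 1 (suc m)) (1-coprimeTo (suc m))))

module TotientValuation where

  open FiniteSums
  open Valuation
  open Totient using (φ-prime-power; φ≥1)
  open import Data.Nat
  open import Data.Nat.Properties
  open import Data.Nat.Divisibility
  open import Data.Nat.Primality using (Prime; prime?; euclidsLemma; prime⇒nonZero)
  open import Data.Nat.Induction using (<-rec)
  open import Data.Product using (_×_; _,_)
  open import Data.Sum using (_⊎_; inj₁; inj₂)
  open import Data.Empty using (⊥-elim)
  open import Relation.Nullary using (¬_; yes; no)
  open import Relation.Binary.PropositionalEquality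
  open import Algebra.Properties.CommutativeSemigroup +-commutativeSemigroup using (x∙yz≈yx∙z; xy∙z≈zy∙x)

  module _ {p : ℕ} (pp : Prime p) where

    weight : ℕ → ℕ
    weight q with prime? q
    ... | yes _ = v p (q ∸ 1)
    ... | no _ = 0

    weight-prime : ∀ {q} → Prime q → weight q ≡ v p (q ∸ 1)
    weight-prime {q} pq with prime? q
    ... | yes _ = refl
    ... | no ¬pq = ⊥-elim (¬pq pq)

    weight-nonprime : ∀ {q} → ¬ Prime q → weight q ≡ 0
    weight-nonprime {q} ¬pq with prime? q
    ... | yes pq = ⊥-elim (¬pq pq)
    ... | no _ = refl

    weight-cases : ∀ q → weight q ≡ 0 ⊎ (Prime q × p ∣ q ∸ 1)
    weight-cases q with prime? q
    ... | no _ = inj₁ refl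
    ... | yes pq with v p (q ∸ 1) ≟ 0
    ...   | yes v≡0 = inj₁ v≡0
    ...   | no v≢0 = inj₂ (pq , v≥1⇒∣ (prime≥2 pp) (n≢0⇒n>0 v≢0))

    weight-pos : ∀ {q} → Prime q → p ∣ q ∸ 1 → 1 ≤ weight q
    weight-pos pq p∣q-1 = subst (1 ≤_) (sym (weight-prime pq)) (∣⇒v≥1 (prime≥2 pp) (∸-monoˡ-≤ 1 (prime≥2 pq)) p∣q-1)

    primeWeights : ℕ → ℕ → ℕ
    primeWeights B m = Σ< B (λ q → weight q * divInd q m)

    primeWeights-one : ∀ B → primeWeights B 1 ≡ 0
    primeWeights-one B = Σ<-zero B term
      where
      term : ∀ q → q < B → weight q * divInd q 1 ≡ 0
      term q _ with q ∣? 1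
      ... | no _ = *-zeroʳ (weight q)
      ... | yes q∣1 = cong (_* 1) (weight-nonprime (λ pq → <⇒≱ (prime≥2 pq) (≤-reflexive (∣1⇒≡1 q∣1))))

    v-pow-pred : ∀ {r} → Prime r → ∀ e → v p (r ^ e) ≡ v p (r ^ suc e) ∸ 1
    v-pow-pred {r} pr e with r ≟ p
    ... | yes refl = trans (v-pow pp e) (cong (_∸ 1) (sym (v-pow pp (suc e))))
    ... | no r≢p = trans (v-pow-other pp pr (≢-sym r≢p) e) (cong (_∸ 1) (sym (v-pow-other pp pr (≢-sym r≢p) (suc e))))

    -- Combining the (v - 1)-terms of two factors of which at most one is divisible by p.
    merge-excess : ∀ t s W F → t ≡ 0 ⊎ s ≡ 0 → (t ∸ 1) + W + (F + (s ∸ 1)) ≡ F + W + (t + s ∸ 1)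
    merge-excess .0 s W F (inj₁ refl) = x∙yz≈yx∙z W F (s ∸ 1)
    merge-excess t .0 W F (inj₂ refl) rewrite +-identityʳ t =
      trans (cong ((t ∸ 1) + W +_) (+-identityʳ F)) (xy∙z≈zy∙x (t ∸ 1) W F)

    module _ {r m' B : ℕ} (pr : Prime r) (r∤m' : ¬ (r ∣ m')) (m'≥1 : 1 ≤ m') (r<B : r < B) (e : ℕ) where

      private
        M = r ^ suc e * m'

      -- The only new prime divisor of M is r.
      primeWeights-step : primeWeights B M ≡ primeWeights B m' + weight r
      primeWeights-step = Σ<-single B r (weight r) _ _ r<B same at-r
        where
        same : ∀ q → q < B → q ≢ r → weight q * divInd q M ≡ weight q * divInd q m'
        same q _ q≢r with prime? q
        ... | no _ = refl
        ... | yes pq = cong (v p (q ∸ 1) *_) (indicator-cong (q ∣? M) (q ∣? m') q∣M⇒q∣m' (∣n⇒∣m*n (r ^ suc e)))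
          where
          q∣M⇒q∣m' : q ∣ M → q ∣ m'
          q∣M⇒q∣m' q∣M with euclidsLemma (r ^ suc e) m' pq q∣M
          ... | inj₁ q∣rᵉ = ⊥-elim (q≢r (prime∣prime-power pq pr (suc e) q∣rᵉ))
          ... | inj₂ q∣m' = q∣m'
        at-r : weight r * divInd r M ≡ weight r * divInd r m' + weight r
        at-r = begin
          weight r * divInd r M  ≡⟨ cong (weight r *_) (indicator-yes (r ∣? M) (∣-trans (m∣m*n (r ^ e)) (m∣m*n m'))) ⟩
          weight r * 1           ≡⟨ *-identityʳ (weight r) ⟩
          weight r               ≡˘⟨ cong (_+ weight r) (*-zeroʳ (weight r)) ⟩
          weight r * 0 + weight r ≡˘⟨ cong (λ x → weight r * x + weight r) (indicator-no (r ∣? m') r∤m') ⟩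
          weight r * divInd r m' + weight r ∎
          where open ≡-Reasoning

      -- φ M = r ^ e (r - 1) φ m'.
      v-φ-step : v p (φ M) ≡ v p (r ^ e) + weight r + v p (φ m')
      v-φ-step = begin
        v p (φ M)                                    ≡⟨ cong (v p) (φ-prime-power pr r∤m' e) ⟩
        v p (r ^ e * (r ∸ 1) * φ m')                 ≡⟨ v-mul pp (*-mono-≤ rᵉ≥1 r-1≥1) (φ≥1 m'≥1) ⟩
        v p (r ^ e * (r ∸ 1)) + v p (φ m')           ≡⟨ cong (_+ v p (φ m')) (v-mul pp rᵉ≥1 r-1≥1) ⟩
        v p (r ^ e) + v p (r ∸ 1) + v p (φ m')       ≡˘⟨ cong (λ w → v p (r ^ e) + w + v p (φ m')) (weight-prime pr) ⟩
        v p (r ^ e) + weight r + v p (φ m')          ∎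
        where
        open ≡-Reasoning
        rᵉ≥1 : 1 ≤ r ^ e
        rᵉ≥1 = m^n>0 r {{prime⇒nonZero pr}} e
        r-1≥1 : 1 ≤ r ∸ 1
        r-1≥1 = ∸-monoˡ-≤ 1 (prime≥2 pr)

      v-disjoint : v p (r ^ suc e) ≡ 0 ⊎ v p m' ≡ 0
      v-disjoint with r ≟ p
      ... | yes refl = inj₂ (v-zero pp r∤m')
      ... | no r≢p = inj₁ (v-pow-other pp pr (≢-sym r≢p) (suc e))

      v-φ-extend : v p (φ m') ≡ primeWeights B m' + (v p m' ∸ 1) → v p (φ M) ≡ primeWeights B M + (v p M ∸ 1)
      v-φ-extend ih = begin
        v p (φ M)                                              ≡⟨ v-φ-step ⟩
        v p (r ^ e) + weight r + v p (φ m')                    ≡⟨ cong₂ (λ x y → x + weight r + y) (v-pow-pred pr e) ih ⟩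
        (t ∸ 1) + weight r + (primeWeights B m' + (s ∸ 1))     ≡⟨ merge-excess t s (weight r) _ v-disjoint ⟩
        primeWeights B m' + weight r + (t + s ∸ 1)
          ≡˘⟨ cong₂ (λ x y → x + (y ∸ 1)) primeWeights-step (v-mul pp (m^n>0 r {{prime⇒nonZero pr}} (suc e)) m'≥1) ⟩
        primeWeights B M + (v p M ∸ 1)                         ∎
        where
        open ≡-Reasoning
        t = v p (r ^ suc e)
        s = v p m'

    -- The p-adic valuation of Euler's function:
    --   v_p(φ m) = Σ_{q prime, q ∣ m} v_p(q - 1) + (v_p(m) - 1)  (truncated subtraction),
    -- where every prime divisor of m is below any bound B > m.
    v-φ : ∀ m → 1 ≤ m → ∀ B → m < B → v p (φ m) ≡ primeWeights B m + (v p m ∸ 1)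
    v-φ = <-rec _ step
      where
      step : ∀ m → (∀ {m'} → m' < m → 1 ≤ m' → ∀ B → m' < B → v p (φ m') ≡ primeWeights B m' + (v p m' ∸ 1)) →
             1 ≤ m → ∀ B → m < B → v p (φ m) ≡ primeWeights B m + (v p m ∸ 1)
      step (suc zero) _ _ B _ = trans v₁≡0 (sym (cong₂ _+_ (primeWeights-one B) (cong (_∸ 1) v₁≡0)))
        where
        v₁≡0 : v p 1 ≡ 0
        v₁≡0 = v-zero pp (λ p∣1 → <⇒≱ (prime≥2 pp) (≤-reflexive (∣1⇒≡1 p∣1)))
      step m@(suc (suc _)) rec m≥1 B m<B with split-prime-power m (s≤s (s≤s z≤n))
      ... | r , e , m' , pr , r∤m' , m≡ =
        subst (λ x → v p (φ x) ≡ primeWeights B x + (v p x ∸ 1)) (sym m≡)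
              (v-φ-extend pr r∤m' m'≥1 r<B e (rec m'<m m'≥1 B (<-trans m'<m m<B)))
        where
        m'≥1 : 1 ≤ m'
        m'≥1 = >-nonZero⁻¹ m' {{m*n≢0⇒n≢0 (r ^ suc e) {{>-nonZero (subst (1 ≤_) m≡ m≥1)}}}}
        rʳ≥2 : 2 ≤ r ^ suc e
        rʳ≥2 = *-mono-≤ (prime≥2 pr) (m^n>0 r {{prime⇒nonZero pr}} e)
        m'<m : m' < m
        m'<m = subst (m' <_) (sym m≡) (subst (_< r ^ suc e * m') (*-identityˡ m') (*-monoˡ-< m' {{>-nonZero m'≥1}} rʳ≥2))
        r<B : r < B
        r<B = ≤-<-trans (∣⇒≤ (subst (r ∣_) (sym m≡) (∣-trans (m∣m*n (r ^ e)) (m∣m*n m')))) m<B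

module Families where

  open FiniteSums
  open Valuation
  open Coprimality using (coprime-*)
  open import Data.Nat
  open import Data.Nat.Properties
  open import Data.Nat.Divisibility
  open import Data.Nat.Coprimality using (Coprime; coprime-divisor)
  open import Data.Nat.Primality using (Prime; euclidsLemma)
  open import Data.Nat.LCM using (lcm; m∣lcm[m,n]; n∣lcm[m,n]; lcm-least)
  open import Data.Nat.ListAction using (product)
  open import Data.List using (applyUpTo)
  open import Data.Product using (_×_; _,_; Σ-syntax)
  open import Data.Sum using (inj₁; inj₂)
  open import Data.Empty using (⊥-elim)
  open import Relation.Nullary using (¬_; yes; no)
  open import Relation.Binary.PropositionalEquality

  Π< : ℕ → (ℕ → ℕ) → ℕ
  Π< n h = product (applyUpTo h n)

  lcm< : ℕ → (ℕ → ℕ) → ℕ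
  lcm< n h = lcmList (applyUpTo h n)

  Positive : ℕ → (ℕ → ℕ) → Set
  Positive n h = ∀ i → i < n → 1 ≤ h i

  Positive-tail : ∀ {n h} → Positive (suc n) h → Positive n (λ i → h (suc i))
  Positive-tail pos i i<n = pos (suc i) (s<s i<n)

  Π<-pos : ∀ n (h : ℕ → ℕ) → Positive n h → 1 ≤ Π< n h
  Π<-pos zero h _ = s≤s z≤n
  Π<-pos (suc n) h pos = *-mono-≤ (pos 0 z<s) (Π<-pos n _ (Positive-tail pos))

  lcm<-pos : ∀ n (h : ℕ → ℕ) → Positive n h → 1 ≤ lcm< n h
  lcm<-pos zero h _ = s≤s z≤n
  lcm<-pos (suc n) h pos = lcm-pos (pos 0 z<s) (lcm<-pos n _ (Positive-tail pos))

  ∣Π< : ∀ n (h : ℕ → ℕ) i → i < n → h i ∣ Π< n h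
  ∣Π< (suc n) h zero _ = m∣m*n _
  ∣Π< (suc n) h (suc i) (s<s i<n) = ∣n⇒∣m*n (h 0) (∣Π< n _ i i<n)

  ∣lcm< : ∀ n (h : ℕ → ℕ) i → i < n → h i ∣ lcm< n h
  ∣lcm< (suc n) h zero _ = m∣lcm[m,n] (h 0) _
  ∣lcm< (suc n) h (suc i) (s<s i<n) = ∣-trans (∣lcm< n _ i i<n) (n∣lcm[m,n] (h 0) _)

  prime∣lcm< : ∀ {q} → Prime q → ∀ n (h : ℕ → ℕ) → q ∣ lcm< n h → Σ[ i ∈ ℕ ] i < n × q ∣ h i
  prime∣lcm< pq zero h q∣1 = ⊥-elim (<⇒≱ (prime≥2 pq) (≤-reflexive (∣1⇒≡1 q∣1)))
  prime∣lcm< {q} pq (suc n) h q∣lcm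
    with euclidsLemma (h 0) (lcm< n (λ i → h (suc i))) pq (∣-trans q∣lcm (lcm-least {h 0} (m∣m*n _) (n∣m*n (h 0))))
  ... | inj₁ q∣h₀ = 0 , z<s , q∣h₀
  ... | inj₂ q∣rest with prime∣lcm< pq n (λ i → h (suc i)) q∣rest
  ... | i , i<n , q∣hᵢ = suc i , s<s i<n , q∣hᵢ

  v-Π< : ∀ {p} → Prime p → ∀ n (h : ℕ → ℕ) → Positive n h → v p (Π< n h) ≡ Σ< n (λ i → v p (h i))
  v-Π< pp zero h _ = v-zero pp (λ p∣1 → <⇒≱ (prime≥2 pp) (≤-reflexive (∣1⇒≡1 p∣1)))
  v-Π< {p} pp (suc n) h pos =
    trans (v-mul pp (pos 0 z<s) (Π<-pos n _ (Positive-tail pos))) (cong (v p (h 0) +_) (v-Π< pp n _ (Positive-tail pos)))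

  v-lcm< : ∀ {p} → Prime p → ∀ n (h : ℕ → ℕ) → Positive n h → v p (lcm< n h) ≡ max< n (λ i → v p (h i))
  v-lcm< pp zero h _ = v-zero pp (λ p∣1 → <⇒≱ (prime≥2 pp) (≤-reflexive (∣1⇒≡1 p∣1)))
  v-lcm< {p} pp (suc n) h pos =
    trans (v-lcm pp (pos 0 z<s) (lcm<-pos n _ (Positive-tail pos))) (cong (v p (h 0) ⊔_) (v-lcm< pp n _ (Positive-tail pos)))

  coprime-Π< : ∀ x n (h : ℕ → ℕ) → (∀ j → j < n → Coprime x (h j)) → Coprime x (Π< n h)
  coprime-Π< x zero h _ (_ , d∣1) = ∣1⇒≡1 d∣1
  coprime-Π< x (suc n) h cop = coprime-* (cop 0 z<s) (coprime-Π< x n _ (λ j j<n → cop (suc j) (s<s j<n)))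

  Π<-∣ : ∀ T n (h : ℕ → ℕ) → (∀ j → j < n → h j ∣ T) →
         (∀ i j → i < n → j < n → i ≢ j → Coprime (h i) (h j)) → Π< n h ∣ T
  Π<-∣ T zero h _ _ = 1∣ T
  Π<-∣ T (suc n) h div cop
    with Π<-∣ T n (λ j → h (suc j)) (λ j j<n → div (suc j) (s<s j<n))
                 (λ i j i<n j<n i≢j → cop (suc i) (suc j) (s<s i<n) (s<s j<n) (λ eq → i≢j (suc-injective eq)))
  ... | divides t T≡ = subst (h 0 * rest ∣_) (sym T≡) (*-monoˡ-∣ rest h₀∣t)
    where
    rest = Π< n (λ j → h (suc j))
    h₀∣t : h 0 ∣ t
    h₀∣t = coprime-divisor (coprime-Π< (h 0) n _ (λ j j<n → cop 0 (suc j) z<s (s<s j<n) (λ ())))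
                           (subst (h 0 ∣_) (trans T≡ (*-comm t rest)) (div 0 z<s))

  module _ {q : ℕ} (pq : Prime q) (k : ℕ) (h : ℕ → ℕ) where

    divCount-uniform : ∀ z → (∀ i → i < suc k → (q ∣ h i → q ∣ z) × (q ∣ z → q ∣ h i)) →
                       Σ< (suc k) (λ i → divInd q (h i)) ≡ divInd q (lcm< (suc k) h) + k * divInd q z
    divCount-uniform z same with q ∣? z
    ... | yes q∣z = begin
      Σ< (suc k) (λ i → divInd q (h i))  ≡⟨ Σ<-cong (suc k) (λ i i<k → indicator-yes (q ∣? h i) (proj₂ (same i i<k) q∣z)) ⟩
      Σ< (suc k) (λ _ → 1)               ≡⟨ Σ<-const (suc k) 1 ⟩
      1 + k * 1
        ≡˘⟨ cong (_+ k * 1) (indicator-yes (q ∣? lcm< (suc k) h) (∣-trans (proj₂ (same 0 z<s) q∣z) (∣lcm< (suc k) h 0 z<s))) ⟩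
      divInd q (lcm< (suc k) h) + k * 1 ∎
      where
      open ≡-Reasoning
      open Data.Product using (proj₂)
    ... | no q∤z = begin
      Σ< (suc k) (λ i → divInd q (h i))  ≡⟨ Σ<-zero (suc k) (λ i i<k → indicator-no (q ∣? h i) (λ q∣hᵢ → q∤z (proj₁ (same i i<k) q∣hᵢ))) ⟩
      0                                  ≡˘⟨ cong₂ _+_ (indicator-no (q ∣? lcm< (suc k) h) q∤lcm) (*-zeroʳ k) ⟩
      divInd q (lcm< (suc k) h) + k * 0  ∎
      where
      open ≡-Reasoning
      open Data.Product using (proj₁)
      q∤lcm : ¬ (q ∣ lcm< (suc k) h)
      q∤lcm q∣lcm with prime∣lcm< pq (suc k) h q∣lcm
      ... | i , i<k , q∣hᵢ = q∤z (proj₁ (same i i<k) q∣hᵢ)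

    divCount-sparse : AtMostOne (suc k) (λ i → q ∣ h i) → Σ< (suc k) (λ i → divInd q (h i)) ≡ divInd q (lcm< (suc k) h)
    divCount-sparse unique with q ∣? lcm< (suc k) h
    ... | no q∤lcm = Σ<-zero (suc k) (λ i i<k → indicator-no (q ∣? h i) (λ q∣hᵢ → q∤lcm (∣-trans q∣hᵢ (∣lcm< (suc k) h i i<k))))
    ... | yes q∣lcm with prime∣lcm< pq (suc k) h q∣lcm
    ... | i₀ , i₀<k , q∣hᵢ₀ =
      trans (Σ<-single (suc k) i₀ 1 _ (λ _ → 0) i₀<k others (indicator-yes (q ∣? h i₀) q∣hᵢ₀))
            (cong (_+ 1) (Σ<-zero (suc k) (λ _ _ → refl)))
      where
      others : ∀ i → i < suc k → i ≢ i₀ → divInd q (h i) ≡ 0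
      others i i<k i≢i₀ = indicator-no (q ∣? h i) (λ q∣hᵢ → i≢i₀ (unique i i₀ i<k i₀<k q∣hᵢ q∣hᵢ₀))

-- The progression T n i = b + a (n + i c), i = 0, …, k, for a prime p ∤ c L_k (so p > k and p ∤ c),
-- and the closed form of g_{p,k,φ} on it.
module Progression (k a b c p : ℕ) (a≥1 : 1 ≤ a) (c≥1 : 1 ≤ c) (pp : Prime p) (p∤cL : ¬ (p ∣ c * L k)) where

  open FiniteSums
  open Valuation
  open Totient using (φ≥1)
  open TotientValuation
  open Families
  open import Data.Nat
  open import Data.Nat.Properties
  open import Data.Nat.Divisibility
  open import Data.Nat.Primality using (Prime; euclidsLemma)
  open import Data.List using (map; applyUpTo)
  open import Data.Nat.ListAction using (product)
  open import Data.List.Properties using (map-applyUpTo)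
  open import Data.Product using (_×_; _,_)
  open import Data.Sum using (inj₁; inj₂; [_,_]′)
  open import Data.Empty using (⊥-elim)
  open import Relation.Nullary using (¬_; yes; no)
  open import Relation.Binary.PropositionalEquality
  open import Relation.Binary.Definitions using (tri<; tri≈; tri>)
  import Data.Integer as ℤ
  open import Data.Integer.Properties using ([+m]-[+n]≡m⊖n; ⊖-≥)
  open import Data.Nat.Tactic.RingSolver using (solve-∀)

  [+x+y]-[+x] : ∀ x y → ℤ.+ (x + y) ℤ.- ℤ.+ x ≡ ℤ.+ y
  [+x+y]-[+x] x y = trans ([+m]-[+n]≡m⊖n (x + y) x) (trans (⊖-≥ (m≤m+n x y)) (cong ℤ.+_ (m+n∸m≡n x y)))

  K : ℕ
  K = suc k

  T : ℕ → ℕ → ℕ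
  T n i = b + a * (n + i * c)

  lcmT : ℕ → ℕ
  lcmT n = lcm< K (T n)

  terms-as-family : ∀ n → terms k a b c n ≡ applyUpTo (T n) K
  terms-as-family n = map-applyUpTo (λ i → i) (T n) K

  T≥1 : ∀ n i → 1 ≤ n → 1 ≤ T n i
  T≥1 n i n≥1 = ≤-trans (*-mono-≤ a≥1 (≤-trans n≥1 (m≤m+n n (i * c)))) (m≤n+m _ b)

  T-from-first : ∀ n i → T n i ≡ (b + a * n) + a * (i * c)
  T-from-first n i = from-first a b c n i
    where
    from-first : ∀ a b c n i → b + a * (n + i * c) ≡ (b + a * n) + a * (i * c)
    from-first = solve-∀

  T-shift : ∀ n i d → T n (i + d) ≡ T n i + a * (d * c)
  T-shift n i d = shift a b c n i d
    where
    shift : ∀ a b c n i d → b + a * (n + (i + d) * c) ≡ (b + a * (n + i * c)) + a * (d * c)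
    shift = solve-∀

  p∤c : ¬ (p ∣ c)
  p∤c p∣c = p∤cL (∣m⇒∣m*n (L k) p∣c)

  k<p : k < p
  k<p with k <? p
  ... | yes k<p = k<p
  ... | no k≮p = ⊥-elim (p∤cL (∣n⇒∣m*n c p∣L))
    where
    p≡ : suc (p ∸ 1) ≡ p
    p≡ = m+[n∸m]≡n (≤-trans (s≤s z≤n) (prime≥2 pp))
    p∣L : p ∣ L k
    p∣L = subst₂ _∣_ p≡ (cong lcmList (sym (map-applyUpTo (λ i → i) suc k)))
                 (∣lcm< k suc (p ∸ 1) (subst (_≤ k) (sym p≡) (≮⇒≥ k≮p)))

  ∣gap : ∀ {m n i j} → i < j → m ∣ T n i → m ∣ T n j → m ∣ a * ((j ∸ i) * c)
  ∣gap {m} {n} {i} {j} i<j m∣Tᵢ m∣Tⱼ = ∣m+n∣m⇒∣n (subst (m ∣_) Tⱼ≡ m∣Tⱼ) m∣Tᵢ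
    where
    Tⱼ≡ : T n j ≡ T n i + a * ((j ∸ i) * c)
    Tⱼ≡ = trans (cong (T n) (sym (m+[n∸m]≡n (<⇒≤ i<j)))) (T-shift n i (j ∸ i))

  AtMostOne-by-gaps : ∀ m n → (∀ d → 1 ≤ d → d ≤ k → ¬ (m ∣ a * (d * c))) → AtMostOne K (λ i → m ∣ T n i)
  AtMostOne-by-gaps m n gaps i j i<K j<K m∣Tᵢ m∣Tⱼ with <-cmp i j
  ... | tri< i<j _ _ = ⊥-elim (gaps (j ∸ i) (m<n⇒0<n∸m i<j) (≤-trans (m∸n≤m j i) (≤-pred j<K)) (∣gap i<j m∣Tᵢ m∣Tⱼ))
  ... | tri≈ _ i≡j _ = i≡j
  ... | tri> _ _ j<i = ⊥-elim (gaps (i ∸ j) (m<n⇒0<n∸m j<i) (≤-trans (m∸n≤m i j) (≤-pred i<K)) (∣gap j<i m∣Tⱼ m∣Tᵢ))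

  small∤ : ∀ {q} d → 1 ≤ d → d ≤ k → k < q → ¬ (q ∣ d)
  small∤ d d≥1 d≤k k<q q∣d = <⇒≱ (≤-<-trans d≤k k<q) (∣⇒≤ {{>-nonZero d≥1}} q∣d)

  -- The common p-adic valuation of all terms but at most one.
  u : ℕ
  u with p ^ v p a ∣? b
  ... | yes _ = v p a
  ... | no _ = v p b

  -- If p ^ v_p(a) ∣ b, every term is divisible by p ^ v_p(a) and at most one by p ^ (v_p(a) + 1),
  -- since the differences a d c have valuation exactly v_p(a).
  valuations-aligned : ∀ n → 1 ≤ n → p ^ v p a ∣ b →
    (∀ i → i < K → v p a ≤ v p (T n i)) × AtMostOne K (λ i → v p (T n i) ≢ v p a)
  valuations-aligned n n≥1 pᵅ∣b = α≤ , λ i j i<K j<K ≢ᵢ ≢ⱼ →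
    AtMostOne-by-gaps (p ^ suc α) n gaps i j i<K j<K (pᵅ⁺¹∣ i i<K ≢ᵢ) (pᵅ⁺¹∣ j j<K ≢ⱼ)
    where
    α = v p a
    α≤ : ∀ i → i < K → α ≤ v p (T n i)
    α≤ i i<K = ∣⇒≤v (prime≥2 pp) (T≥1 n i n≥1) (∣m∣n⇒∣m+n pᵅ∣b (∣m⇒∣m*n _ (v-divides a (prime≥2 pp))))
    pᵅ⁺¹∣ : ∀ i → i < K → v p (T n i) ≢ α → p ^ suc α ∣ T n i
    pᵅ⁺¹∣ i i<K v≢α = ≤v⇒∣ (prime≥2 pp) (≤∧≢⇒< (α≤ i i<K) (≢-sym v≢α))
    v≡α : ∀ d → 1 ≤ d → d ≤ k → v p (a * (d * c)) ≡ α
    v≡α d d≥1 d≤k = begin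
      v p (a * (d * c))       ≡⟨ v-mul pp a≥1 (*-mono-≤ d≥1 c≥1) ⟩
      α + v p (d * c)         ≡⟨ cong (α +_) (v-mul pp d≥1 c≥1) ⟩
      α + (v p d + v p c)     ≡⟨ cong₂ (λ x y → α + (x + y)) (v-zero pp (small∤ d d≥1 d≤k k<p)) (v-zero pp p∤c) ⟩
      α + 0                   ≡⟨ +-identityʳ α ⟩
      α                       ∎
      where open ≡-Reasoning
    gaps : ∀ d → 1 ≤ d → d ≤ k → ¬ (p ^ suc α ∣ a * (d * c))
    gaps d d≥1 d≤k pᵅ⁺¹∣ = 1+n≰n (≤-trans (∣⇒≤v (prime≥2 pp) (*-mono-≤ a≥1 (*-mono-≤ d≥1 c≥1)) pᵅ⁺¹∣) (≤-reflexive (v≡α d d≥1 d≤k)))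

  -- If p ^ v_p(a) ∤ b, then v_p(b) < v_p(a) and every term has valuation v_p(b).
  valuations-constant : ∀ n → 1 ≤ n → ¬ (p ^ v p a ∣ b) → ∀ i → v p (T n i) ≡ v p b
  valuations-constant n n≥1 pᵅ∤b i =
    v-exact (prime≥2 pp) (T≥1 n i n≥1) (∣m∣n⇒∣m+n (v-divides b (prime≥2 pp)) (∣-trans (n∣m*n p) pᵝ⁺¹∣aX))
            (λ pᵝ⁺¹∣T → 1+n≰n (∣⇒≤v (prime≥2 pp) b≥1 (∣m+n∣n⇒∣m pᵝ⁺¹∣T pᵝ⁺¹∣aX)))
    where
    β = v p b
    β<α : β < v p a
    β<α = ≰⇒> (λ α≤β → pᵅ∤b (≤v⇒∣ (prime≥2 pp) α≤β))
    b≥1 : 1 ≤ b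
    b≥1 = n≢0⇒n>0 (λ b≡0 → pᵅ∤b (subst (p ^ v p a ∣_) (sym b≡0) ((p ^ v p a) ∣0)))
    pᵝ⁺¹∣aX : p ^ suc β ∣ a * (n + i * c)
    pᵝ⁺¹∣aX = ∣m⇒∣m*n (n + i * c) (∣-trans (^-monoʳ-∣ p β<α) (v-divides a (prime≥2 pp)))

  p-valuations : ∀ n → 1 ≤ n → (∀ i → i < K → u ≤ v p (T n i)) × AtMostOne K (λ i → v p (T n i) ≢ u)
  p-valuations n n≥1 with p ^ v p a ∣? b
  ... | yes pᵅ∣b = valuations-aligned n n≥1 pᵅ∣b
  ... | no pᵅ∤b = (λ i _ → ≤-reflexive (sym (valuations-constant n n≥1 pᵅ∤b i))) ,
                  (λ i _ _ _ v≢u _ → ⊥-elim (v≢u (valuations-constant n n≥1 pᵅ∤b i)))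

  -- Σ_i [q ∣ T n i] - [q ∣ lcm_i T n i] for a prime q > k: all terms are congruent modulo
  -- q when q ∣ a (to b) or q ∣ c (to b + a n); otherwise at most one term is a multiple of q.
  divExcess : ℕ → ℕ → ℕ
  divExcess q n with q ∣? a | q ∣? c
  ... | yes _ | _ = k * divInd q b
  ... | no _ | yes _ = k * divInd q (b + a * n)
  ... | no _ | no _ = 0

  divCount : ∀ {q} n → Prime q → k < q → Σ< K (λ i → divInd q (T n i)) ≡ divInd q (lcmT n) + divExcess q n
  divCount {q} n pq k<q with q ∣? a | q ∣? c
  ... | yes q∣a | _ =
    divCount-uniform pq k (T n) b (λ i _ → (λ q∣T → ∣m+n∣n⇒∣m q∣T (q∣aX _)) , (λ q∣b → ∣m∣n⇒∣m+n q∣b (q∣aX _)))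
    where
    q∣aX : ∀ X → q ∣ a * X
    q∣aX X = ∣m⇒∣m*n X q∣a
  ... | no _ | yes q∣c = divCount-uniform pq k (T n) (b + a * n) (λ i _ →
      (λ q∣T → ∣m+n∣n⇒∣m (subst (q ∣_) (T-from-first n i) q∣T) (q∣aic i)) ,
      (λ q∣ → subst (q ∣_) (sym (T-from-first n i)) (∣m∣n⇒∣m+n q∣ (q∣aic i))))
    where
    q∣aic : ∀ i → q ∣ a * (i * c)
    q∣aic i = ∣n⇒∣m*n a (∣n⇒∣m*n i q∣c)
  ... | no q∤a | no q∤c = trans (divCount-sparse pq k (T n) (AtMostOne-by-gaps q n gaps)) (sym (+-identityʳ _))
    where
    gaps : ∀ d → 1 ≤ d → d ≤ k → ¬ (q ∣ a * (d * c))
    gaps d d≥1 d≤k q∣adc with euclidsLemma a (d * c) pq q∣adc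
    ... | inj₁ q∣a = q∤a q∣a
    ... | inj₂ q∣dc = [ small∤ d d≥1 d≤k k<q , q∤c ]′ (euclidsLemma d c pq q∣dc)

  -- Primes of positive weight are ≡ 1 (mod p), hence exceed p > k.
  weighted-divCount : ∀ n q → weight pp q * Σ< K (λ i → divInd q (T n i)) ≡
                              weight pp q * divInd q (lcmT n) + weight pp q * divExcess q n
  weighted-divCount n q with weight-cases pp q
  ... | inj₁ w≡0 rewrite w≡0 = refl
  ... | inj₂ (pq , p∣q-1) = trans (cong (weight pp q *_) (divCount n pq k<q)) (*-distribˡ-+ (weight pp q) _ _)
    where
    k<q : k < q
    k<q = <-≤-trans k<p (≤-trans (∣⇒≤ {{>-nonZero (∸-monoˡ-≤ 1 (prime≥2 pq))}} p∣q-1) (m∸n≤m q 1))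

  -- Primes dividing a or c lie below Q.
  Q : ℕ
  Q = suc (a + c)

  divExcess-vanishes : ∀ q n → Q ≤ q → divExcess q n ≡ 0
  divExcess-vanishes q n Q≤q with q ∣? a | q ∣? c
  ... | yes q∣a | _ = ⊥-elim (<⇒≱ (≤-trans (s≤s (m≤m+n a c)) Q≤q) (∣⇒≤ {{>-nonZero a≥1}} q∣a))
  ... | no _ | yes q∣c = ⊥-elim (<⇒≱ (≤-trans (s≤s (m≤n+m c a)) Q≤q) (∣⇒≤ {{>-nonZero c≥1}} q∣c))
  ... | no _ | no _ = refl

  E : ℕ → ℕ
  E n = Σ< Q (λ q → weight pp q * divExcess q n)

  Σ-primeWeights : ∀ n B → Q ≤ B → Σ< K (λ i → primeWeights pp B (T n i)) ≡ primeWeights pp B (lcmT n) + E n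
  Σ-primeWeights n B Q≤B = begin
    Σ< K (λ i → Σ< B (λ q → weight pp q * divInd q (T n i)))
      ≡⟨ Σ<-swap K B (λ q i → weight pp q * divInd q (T n i)) ⟩
    Σ< B (λ q → Σ< K (λ i → weight pp q * divInd q (T n i)))
      ≡⟨ Σ<-cong B (λ q _ → trans (Σ<-*ˡ K (weight pp q) (λ i → divInd q (T n i))) (weighted-divCount n q)) ⟩
    Σ< B (λ q → weight pp q * divInd q (lcmT n) + weight pp q * divExcess q n)
      ≡⟨ Σ<-+ B _ _ ⟩
    primeWeights pp B (lcmT n) + Σ< B (λ q → weight pp q * divExcess q n)
      ≡⟨ cong (primeWeights pp B (lcmT n) +_) (Σ<-extend Q B _ Q≤B vanish) ⟩
    primeWeights pp B (lcmT n) + E n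
      ∎
    where
    open ≡-Reasoning
    vanish : ∀ q → Q ≤ q → weight pp q * divExcess q n ≡ 0
    vanish q Q≤q = trans (cong (weight pp q *_) (divExcess-vanishes q n Q≤q)) (*-zeroʳ (weight pp q))

  Σ-excessValuations : ∀ n → 1 ≤ n → Σ< K (λ i → v p (T n i) ∸ 1) ≡ k * (u ∸ 1) + (v p (lcmT n) ∸ 1)
  Σ-excessValuations n n≥1 with p-valuations n n≥1
  ... | u≤ , unique = trans (Σ<-excess k (λ i → v p (T n i)) u u≤ unique)
                            (cong (λ x → k * (u ∸ 1) + (x ∸ 1)) (sym (v-lcm< pp K (T n) (λ i _ → T≥1 n i n≥1))))

  -- A bound exceeding the lcm of the terms (hence every term) and Q.
  B : ℕ → ℕ
  B n = suc (lcmT n + Q)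

  lcmT≥1 : ∀ n → 1 ≤ n → 1 ≤ lcmT n
  lcmT≥1 n n≥1 = lcm<-pos K (T n) (λ i _ → T≥1 n i n≥1)

  T<B : ∀ n → 1 ≤ n → ∀ i → i < K → T n i < B n
  T<B n n≥1 i i<K = s≤s (≤-trans (∣⇒≤ {{>-nonZero (lcmT≥1 n n≥1)}} (∣lcm< K (T n) i i<K)) (m≤m+n (lcmT n) Q))

  v-denominator : ∀ n → 1 ≤ n → v p (gDen k a b c n) ≡ primeWeights pp (B n) (lcmT n) + (v p (lcmT n) ∸ 1)
  v-denominator n n≥1 =
    trans (cong (λ ts → v p (φ (lcmList ts))) (terms-as-family n)) (v-φ pp (lcmT n) (lcmT≥1 n n≥1) (B n) (s≤s (m≤m+n (lcmT n) Q)))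

  v-numerator : ∀ n → 1 ≤ n → v p (gNum k a b c n) ≡ v p (gDen k a b c n) + (E n + k * (u ∸ 1))
  v-numerator n n≥1 = begin
    v p (gNum k a b c n)                                 ≡⟨ cong (λ ts → v p (product (map φ ts))) (terms-as-family n) ⟩
    v p (product (map φ (applyUpTo (T n) K)))            ≡⟨ cong (λ ts → v p (product ts)) (map-applyUpTo (T n) φ K) ⟩
    v p (Π< K (λ i → φ (T n i)))                         ≡⟨ v-Π< pp K _ (λ i _ → φ≥1 (T≥1 n i n≥1)) ⟩
    Σ< K (λ i → v p (φ (T n i)))                         ≡⟨ Σ<-cong K (λ i i<K → v-φ pp (T n i) (T≥1 n i n≥1) (B n) (T<B n n≥1 i i<K)) ⟩
    Σ< K (λ i → W (T n i) + (v p (T n i) ∸ 1))           ≡⟨ Σ<-+ K (λ i → W (T n i)) (λ i → v p (T n i) ∸ 1) ⟩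
    Σ< K (λ i → W (T n i)) + Σ< K (λ i → v p (T n i) ∸ 1)
      ≡⟨ cong₂ _+_ (Σ-primeWeights n (B n) (m≤n+m Q (suc (lcmT n)))) (Σ-excessValuations n n≥1) ⟩
    W (lcmT n) + E n + (k * (u ∸ 1) + (v p (lcmT n) ∸ 1)) ≡⟨ regroup (W (lcmT n)) (E n) (k * (u ∸ 1)) (v p (lcmT n) ∸ 1) ⟩
    W (lcmT n) + (v p (lcmT n) ∸ 1) + (E n + k * (u ∸ 1)) ≡˘⟨ cong (_+ (E n + k * (u ∸ 1))) (v-denominator n n≥1) ⟩
    v p (gDen k a b c n) + (E n + k * (u ∸ 1))           ∎
    where
    open ≡-Reasoning
    W : ℕ → ℕ
    W = primeWeights pp (B n)
    regroup : ∀ w e x y → w + e + (x + y) ≡ w + y + (e + x)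
    regroup = solve-∀

  gp-closed-form : ∀ n → 1 ≤ n → gp p k a b c n ≡ ℤ.+ (E n + k * (u ∸ 1))
  gp-closed-form n n≥1 = trans (cong (λ x → ℤ.+ x ℤ.- ℤ.+ v p (gDen k a b c n)) (v-numerator n n≥1))
                               ([+x+y]-[+x] (v p (gDen k a b c n)) (E n + k * (u ∸ 1)))

module Period (k a b c p : ℕ) (k≥1 : 1 ≤ k) (a≥1 : 1 ≤ a) (c≥1 : 1 ≤ c) (pp : Prime p) (p∤cL : ¬ (p ∣ c * L k)) where

  open FiniteSums
  open Valuation using (prime≥2; ∣m+n∣n⇒∣m)
  open Coprimality using (coprime-prime; distinct-primes-coprime; linear-congruence)
  open TotientValuation
  open Families
  open import Data.Nat
  open import Data.Nat.Properties
  open import Data.Nat.Divisibility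
  open import Data.Nat.Coprimality using (Coprime; 1-coprimeTo)
  open import Data.Nat.Primality using (Prime; prime?; euclidsLemma)
  open import Data.Nat.ListAction using (product)
  open import Data.List.Properties using (map-applyUpTo)
  open import Data.Bool using (if_then_else_; _∧_; not)
  open import Data.Product using (_×_; _,_; proj₁; proj₂; Σ-syntax)
  open import Data.Sum using (_⊎_; inj₁; inj₂; [_,_]′)
  open import Data.Empty using (⊥-elim)
  open import Relation.Nullary using (¬_; yes; no; does)
  open import Relation.Binary.PropositionalEquality
  import Data.Integer as ℤ
  open import Data.Integer.Properties using () renaming (+-injective to ℤ+-injective)

  open Progression k a b c p a≥1 c≥1 pp p∤cL

  Selected : ℕ → Set
  Selected q = Prime q × q ∣ c × ¬ (q ∣ a) × p ∣ q ∸ 1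

  factor : ℕ → ℕ
  factor q = if does (prime? q) ∧ does (q ∣? c) ∧ not (does (q ∣? a)) ∧ does (p ∣? (q ∸ 1)) then q else 1

  D : ℕ
  D = primeProd p a c

  D-as-product : D ≡ Π< (suc c) factor
  D-as-product = cong product (map-applyUpTo (λ i → i) factor (suc c))

  factor-cases : ∀ q → (factor q ≡ q × Selected q) ⊎ factor q ≡ 1
  factor-cases q with prime? q | q ∣? c | q ∣? a | p ∣? (q ∸ 1)
  ... | yes pq | yes q∣c | no q∤a | yes p∣q-1 = inj₁ (refl , pq , q∣c , q∤a , p∣q-1)
  ... | no _   | _       | _      | _         = inj₂ refl
  ... | yes _  | no _    | _      | _         = inj₂ refl
  ... | yes _  | yes _   | yes _  | _         = inj₂ refl
  ... | yes _  | yes _   | no _   | no _      = inj₂ refl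

  factor-selected : ∀ {q} → Selected q → factor q ≡ q
  factor-selected {q} (pq , q∣c , q∤a , p∣q-1) with prime? q | q ∣? c | q ∣? a | p ∣? (q ∸ 1)
  ... | yes _  | yes _    | no _    | yes _    = refl
  ... | no ¬pq | _        | _       | _        = ⊥-elim (¬pq pq)
  ... | yes _  | no q∤c   | _       | _        = ⊥-elim (q∤c q∣c)
  ... | yes _  | yes _    | yes q∣a | _        = ⊥-elim (q∤a q∣a)
  ... | yes _  | yes _    | no _    | no p∤q-1 = ⊥-elim (p∤q-1 p∣q-1)

  selected≤c : ∀ {q} → Selected q → q ≤ c
  selected≤c (_ , q∣c , _) = ∣⇒≤ {{>-nonZero c≥1}} q∣c

  D≥1 : 1 ≤ D
  D≥1 = subst (1 ≤_) (sym D-as-product) (Π<-pos (suc c) factor pos)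
    where
    pos : Positive (suc c) factor
    pos q _ with factor-cases q
    ... | inj₁ (eq , pq , _) = subst (1 ≤_) (sym eq) (≤-trans (s≤s z≤n) (prime≥2 pq))
    ... | inj₂ eq = ≤-reflexive (sym eq)

  selected∣D : ∀ {q} → Selected q → q ∣ D
  selected∣D {q} sel = subst (q ∣_) (sym D-as-product) (subst (_∣ Π< (suc c) factor) (factor-selected sel) (∣Π< (suc c) factor q (s≤s (selected≤c sel))))

  coprime-a-D : Coprime a D
  coprime-a-D = subst (Coprime a) (sym D-as-product) (coprime-Π< a (suc c) factor cop)
    where
    cop : ∀ q → q < suc c → Coprime a (factor q)
    cop q _ with factor-cases q
    ... | inj₁ (eq , pq , _ , q∤a , _) = subst (Coprime a) (sym eq) (coprime-prime pq q∤a)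
    ... | inj₂ eq = subst (Coprime a) (sym eq) (λ (_ , d∣1) → ∣1⇒≡1 d∣1)

  D∣ : ∀ T′ → (∀ {q} → Selected q → q ∣ T′) → D ∣ T′
  D∣ T′ sel∣ = subst (_∣ T′) (sym D-as-product) (Π<-∣ T′ (suc c) factor div cop)
    where
    div : ∀ q → q < suc c → factor q ∣ T′
    div q _ with factor-cases q
    ... | inj₁ (eq , sel) = subst (_∣ T′) (sym eq) (sel∣ sel)
    ... | inj₂ eq = subst (_∣ T′) (sym eq) (1∣ T′)
    cop : ∀ i j → i < suc c → j < suc c → i ≢ j → Coprime (factor i) (factor j)
    cop i j _ _ i≢j with factor-cases i | factor-cases j
    ... | inj₂ eq | _ = subst (λ z → Coprime z (factor j)) (sym eq) (1-coprimeTo (factor j))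
    ... | inj₁ _ | inj₂ eq = subst (Coprime (factor i)) (sym eq) (λ (_ , d∣1) → ∣1⇒≡1 d∣1)
    ... | inj₁ (eqᵢ , pi , _) | inj₁ (eqⱼ , pj , _) = subst₂ Coprime (sym eqᵢ) (sym eqⱼ) (distinct-primes-coprime pi pj i≢j)

  divExcess-selected : ∀ {q} n → Selected q → divExcess q n ≡ k * divInd q (b + a * n)
  divExcess-selected {q} n (_ , q∣c , q∤a , _) with q ∣? a | q ∣? c
  ... | yes q∣a | _ = ⊥-elim (q∤a q∣a)
  ... | no _ | no q∤c = ⊥-elim (q∤c q∣c)
  ... | no _ | yes _ = refl

  shift-first : ∀ n m → b + a * (n + m) ≡ (b + a * n) + a * m
  shift-first n m = trans (cong (b +_) (*-distribˡ-+ a n m)) (sym (+-assoc b (a * n) (a * m)))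

  -- Only selected primes make the excess depend on n, and they all divide D.
  weightedExcess-periodic : ∀ q n → weight pp q * divExcess q (n + D) ≡ weight pp q * divExcess q n
  weightedExcess-periodic q n with weight-cases pp q
  ... | inj₁ w≡0 rewrite w≡0 = refl
  ... | inj₂ (pq , p∣q-1) = cong (weight pp q *_) excess-periodic
    where
    excess-periodic : divExcess q (n + D) ≡ divExcess q n
    excess-periodic with q ∣? a | q ∣? c
    ... | yes _ | _ = refl
    ... | no _ | no _ = refl
    ... | no q∤a | yes q∣c = cong (k *_) (indicator-cong (q ∣? (b + a * (n + D))) (q ∣? (b + a * n))
            (λ q∣ → ∣m+n∣n⇒∣m (subst (q ∣_) (shift-first n D) q∣) q∣aD)
            (λ q∣ → subst (q ∣_) (sym (shift-first n D)) (∣m∣n⇒∣m+n q∣ q∣aD)))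
      where
      q∣aD : q ∣ a * D
      q∣aD = ∣n⇒∣m*n a (selected∣D (pq , q∣c , q∤a , p∣q-1))

  gp-periodic : IsPeriod (gp p k a b c) D
  gp-periodic = D≥1 , λ n n≥1 → begin
    gp p k a b c (n + D)           ≡⟨ gp-closed-form (n + D) (≤-trans n≥1 (m≤m+n n D)) ⟩
    ℤ.+ (E (n + D) + k * (u ∸ 1))  ≡⟨ cong (λ e → ℤ.+ (e + k * (u ∸ 1))) (Σ<-cong Q (λ q _ → weightedExcess-periodic q n)) ⟩
    ℤ.+ (E n + k * (u ∸ 1))        ≡˘⟨ gp-closed-form n n≥1 ⟩
    gp p k a b c n                 ∎
    where open ≡-Reasoning

  n₀-solution : Σ[ n ∈ ℕ ] 1 ≤ n × D ∣ b + a * n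
  n₀-solution = linear-congruence a b D D≥1 coprime-a-D

  n₀ : ℕ
  n₀ = proj₁ n₀-solution

  n₀≥1 : 1 ≤ n₀
  n₀≥1 = proj₁ (proj₂ n₀-solution)

  selected∣first : ∀ {q} → Selected q → q ∣ b + a * n₀
  selected∣first sel = ∣-trans (selected∣D sel) (proj₂ (proj₂ n₀-solution))

  -- Each weighted excess, hence E, is maximal at n₀.
  weightedExcess≤ : ∀ q n → weight pp q * divExcess q n ≤ weight pp q * divExcess q n₀
  weightedExcess≤ q n with weight-cases pp q
  ... | inj₁ w≡0 rewrite w≡0 = z≤n
  ... | inj₂ (pq , p∣q-1) = *-monoʳ-≤ (weight pp q) excess≤
    where
    excess≤ : divExcess q n ≤ divExcess q n₀
    excess≤ with q ∣? a | q ∣? c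
    ... | yes _ | _ = ≤-refl
    ... | no _ | no _ = ≤-refl
    ... | no q∤a | yes q∣c = *-monoʳ-≤ k (subst (divInd q (b + a * n) ≤_) (sym first≡1) (indicator≤1 (q ∣? (b + a * n))))
      where
      first≡1 : divInd q (b + a * n₀) ≡ 1
      first≡1 = indicator-yes (q ∣? (b + a * n₀)) (selected∣first (pq , q∣c , q∤a , p∣q-1))

  -- A period T′ keeps E at its maximum at n₀ + T′, so every selected prime divides b + a (n₀ + T′),
  -- hence a T′, hence T′.
  selected∣period : ∀ {T′} → IsPeriod (gp p k a b c) T′ → ∀ {q} → Selected q → q ∣ T′
  selected∣period {T′} (_ , periodic) {q} sel@(pq , q∣c , q∤a , p∣q-1) =
    [ (λ q∣a → ⊥-elim (q∤a q∣a)) , (λ q∣T′ → q∣T′) ]′ (euclidsLemma a T′ pq q∣aT′)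
    where
    E-equal : E (n₀ + T′) ≡ E n₀
    E-equal = +-cancelʳ-≡ (k * (u ∸ 1)) _ _ (ℤ+-injective (begin
      ℤ.+ (E (n₀ + T′) + k * (u ∸ 1)) ≡˘⟨ gp-closed-form (n₀ + T′) (≤-trans n₀≥1 (m≤m+n n₀ T′)) ⟩
      gp p k a b c (n₀ + T′)          ≡⟨ periodic n₀ n₀≥1 ⟩
      gp p k a b c n₀                 ≡⟨ gp-closed-form n₀ n₀≥1 ⟩
      ℤ.+ (E n₀ + k * (u ∸ 1))        ∎))
      where open ≡-Reasoning
    q-term : weight pp q * divExcess q (n₀ + T′) ≡ weight pp q * divExcess q n₀
    q-term = Σ<-≤-equal Q _ _ (λ r _ → weightedExcess≤ r (n₀ + T′)) E-equal q (s≤s (≤-trans (selected≤c sel) (m≤n+m c a)))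
    indicator-equal : divInd q (b + a * (n₀ + T′)) ≡ divInd q (b + a * n₀)
    indicator-equal = *-cancelˡ-≡ _ _ k {{>-nonZero k≥1}} (begin
      k * divInd q (b + a * (n₀ + T′)) ≡˘⟨ divExcess-selected (n₀ + T′) sel ⟩
      divExcess q (n₀ + T′)            ≡⟨ *-cancelˡ-≡ _ _ (weight pp q) {{>-nonZero (weight-pos pp pq p∣q-1)}} q-term ⟩
      divExcess q n₀                   ≡⟨ divExcess-selected n₀ sel ⟩
      k * divInd q (b + a * n₀)        ∎)
      where open ≡-Reasoning
    q∣shifted : q ∣ b + a * (n₀ + T′)
    q∣shifted = indicator≡1⇒ (q ∣? (b + a * (n₀ + T′))) (trans indicator-equal (indicator-yes (q ∣? (b + a * n₀)) (selected∣first sel)))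
    q∣aT′ : q ∣ a * T′
    q∣aT′ = ∣m+n∣m⇒∣n (subst (q ∣_) (shift-first n₀ T′) q∣shifted) (selected∣first sel)

  gp-minimal : ∀ T′ → IsPeriod (gp p k a b c) T′ → D ≤ T′
  gp-minimal T′ per = ∣⇒≤ {{>-nonZero (proj₁ per)}} (D∣ T′ (selected∣period per))

lemma3p4 : (k a b c p : ℕ) → 1 ≤ k → 1 ≤ a → 1 ≤ c → Prime p →
    p ≤ c * L k → ¬ (p ∣ c * L k) →
    IsSmallestPeriod (gp p k a b c) (primeProd p a c)
lemma3p4 k a b c p k≥1 a≥1 c≥1 pp _ p∤cL = gp-periodic , gp-minimal
  where
  open Period k a b c p k≥1 a≥1 c≥1 pp p∤cL
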